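{- Let $T_1,T_2$ be vertex-disjoint trees, let $v$ be a vertex of $T_1$ and $w$ a vertex of $T_2$, and let $e$ be the edge $vw$. Let $T_1'=T_1\cup\{e\}$ (the tree $T_1$ with the vertex $w$ and the edge $e$ added), $T_2'=T_2\cup\{e\}$ (the tree $T_2$ with the vertex $v$ and the edge $e$ added), and $T=T_1\cup T_2\cup\{e\}$. Then, as rational functions in $y,z$, \[\overline{H}_T=\frac{y}{y+z}\left(\overline{H}_{T_1'}+\overline{H}_{T_2'}\right)+\frac{z}{y+z}\,\overline{H}_{T\odot e}.\]
   Context: For a tree $T$, a subtree is a connected subgraph with nonempty vertex set. For a subtree $S$, let $e(S)$ be the number of edges of $T$ with both endpoints in $V(S)$, and $d(S)$ the number of edges of $T$ with exactly one endpoint in $V(S)$. Let $\mathcal{S}'(T)$ be the set of subtrees of $T$ containing at least one non-leaf vertex of $T$, and define $\overline{H}_T=\sum_{S\in\mathcal{S}'(T)}y^{d(S)}z^{e(S)}$. For an edge $e=vw$ of $T$, the near-contraction $T\odot e$ is the tree on the same vertex set with edge set $\big(E(T)\setminus\{wx: x\notin\{v,w\}\}\big)\cup\{vx: wx\in E(T),\ x\notin\{v,w\}\}$. In words, every neighbor of $w$ other than $v$ is reattached to $v$, and $w$ becomes a leaf adjacent to $v$. -}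

module Defs where

open import Data.Nat using (ℕ; zero; suc; _≤_)
open import Data.Bool using (Bool; true; false; _∧_; _xor_; if_then_else_)
open import Data.Fin using (Fin; _≟_)
open import Data.Fin.Subset using (Subset; _∈_; _∉_; _⊆_; _∪_; ⁅_⁆)
open import Data.Vec using (lookup)
open import Data.List using (List; []; _∷_; _++_; length; filter; map; sum; foldr)
open import Data.List.Relation.Unary.AllPairs using (AllPairs)
open import Data.List.Relation.Unary.Unique.Propositional using (Unique)
import Data.List.Membership.Propositional as LM
open import Data.Product using (_×_; _,_; Σ; ∃; proj₁; proj₂)
open import Data.Sum using (_⊎_)
open import Relation.Binary.PropositionalEquality using (_≡_; _≢_)
open import Relation.Nullary using (¬_; does)
open import Function.Bundles using (_⇔_)
open import Data.Rational using (ℚ; 0ℚ; 1ℚ; _*_; _+_)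
open import Relation.Nullary.Decidable using (_⊎-dec_)
open import Relation.Nullary.Decidable using (T?)
open import Data.Bool using (T)

-- A graph is a vertex set (a subset of Fin N) and a list of edges,
-- each edge an (ordered representative of an unordered) pair.

Edge : ℕ → Set
Edge N = Fin N × Fin N

record Graph (N : ℕ) : Set where
  constructor graph
  field
    verts : Subset N
    edges : List (Edge N)
open Graph public

SameEdge : ∀ {N} → Edge N → Edge N → Set
SameEdge (a , b) (c , d) = ((a ≡ c) × (b ≡ d)) ⊎ ((a ≡ d) × (b ≡ c))

record IsSimple {N : ℕ} (G : Graph N) : Set where
  field
    endpoints : ∀ {a b} → (a , b) LM.∈ edges G → (a ∈ verts G) × (b ∈ verts G)
    noLoops   : ∀ {a b} → (a , b) LM.∈ edges G → a ≢ b
    noMulti   : AllPairs (λ e f → ¬ SameEdge e f) (edges G)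

Adj : ∀ {N} → Graph N → Fin N → Fin N → Set
Adj G a b = ((a , b) LM.∈ edges G) ⊎ ((b , a) LM.∈ edges G)

data WalkIn {N : ℕ} (G : Graph N) (U : Subset N) : Fin N → Fin N → Set where
  here : ∀ {a} → a ∈ U → WalkIn G U a a
  step : ∀ {a b c} → a ∈ U → Adj G a b → WalkIn G U b c → WalkIn G U a c

data Chain {N : ℕ} (G : Graph N) : List (Fin N) → Set where
  nil  : Chain G []
  one  : ∀ {a} → Chain G (a ∷ [])
  cons : ∀ {a b l} → Adj G a b → Chain G (b ∷ l) → Chain G (a ∷ b ∷ l)

-- a cycle: a list of at least three distinct vertices v₀ … v_k such that
-- consecutive entries are adjacent and v_k is adjacent to v₀
-- (encoded as: the closed list v₀ … v_k v₀ is a chain)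
record Cycle {N : ℕ} (G : Graph N) : Set where
  field
    v₀       : Fin N
    rest     : List (Fin N)
    long     : 2 ≤ length rest
    distinct : Unique (v₀ ∷ rest)
    closed   : Chain G (v₀ ∷ (rest ++ (v₀ ∷ [])))

Connected : ∀ {N} → Graph N → Set
Connected G = ∀ {a b} → a ∈ verts G → b ∈ verts G → WalkIn G (verts G) a b

record IsTree {N : ℕ} (T : Graph N) : Set where
  field
    simple    : IsSimple T
    nonempty  : ∃ λ a → a ∈ verts T
    connected : Connected T
    acyclic   : ¬ Cycle T

inB : ∀ {N} → Subset N → Fin N → Bool
inB S x = lookup S x

deg : ∀ {N} → Graph N → Fin N → ℕ
deg G x = length (filter (λ e → (x ≟ proj₁ e) ⊎-dec (x ≟ proj₂ e)) (edges G))

IsLeaf : ∀ {N} → Graph N → Fin N → Set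
IsLeaf G x = deg G x ≡ 1

-- subtree of T (identified with its vertex set; a connected subgraph of a
-- tree is the induced subgraph on its vertex set): a nonempty set S of
-- vertices of T such that any two of them are joined by a walk inside S.
record IsSubtree {N : ℕ} (T : Graph N) (S : Subset N) : Set where
  field
    inside    : S ⊆ verts T
    nonempty  : ∃ λ a → a ∈ S
    connected : ∀ {a b} → a ∈ S → b ∈ S → WalkIn T S a b

IsSubtree' : ∀ {N} → Graph N → Subset N → Set
IsSubtree' T S = IsSubtree T S × (∃ λ a → (a ∈ S) × ¬ IsLeaf T a)

eS : ∀ {N} → Graph N → Subset N → ℕ
eS T S = length (filter (λ e → T? (inB S (proj₁ e) ∧ inB S (proj₂ e))) (edges T))

dS : ∀ {N} → Graph N → Subset N → ℕ
dS T S = length (filter (λ e → T? (inB S (proj₁ e) xor inB S (proj₂ e))) (edges T))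

Enumerates' : ∀ {N} → Graph N → List (Subset N) → Set
Enumerates' T L = Unique L × (∀ S → (S LM.∈ L) ⇔ IsSubtree' T S)

-- Evaluation of H̄_T = Σ_{S ∈ 𝒮'(T)} y^{d(S)} z^{e(S)} at rationals y, z,
-- given an enumeration L of 𝒮'(T).

_^ℚ_ : ℚ → ℕ → ℚ
x ^ℚ zero  = 1ℚ
x ^ℚ suc n = x * (x ^ℚ n)

Hbar : ∀ {N} → Graph N → List (Subset N) → ℚ → ℚ → ℚ
Hbar T L y z = foldr (λ S acc → ((y ^ℚ dS T S) * (z ^ℚ eS T S)) + acc) 0ℚ L

-- near-contraction T ⊙ e for e = vw: every edge wx with x ≠ v becomes vx
reattach : ∀ {N} → Fin N → Fin N → Edge N → Edge N
reattach v w (a , b) with does (a ≟ w) | does (b ≟ v) | does (b ≟ w) | does (a ≟ v)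
... | true  | false | _    | _     = (v , b)
... | _     | _     | true | false = (a , v)
... | _     | _     | _    | _     = (a , b)

nearContract : ∀ {N} → Graph N → Fin N → Fin N → Graph N
nearContract T v w = graph (verts T) (map (reattach v w) (edges T))

addEdge : ∀ {N} → Graph N → Fin N → Fin N → Fin N → Graph N
addEdge G x a b = graph (verts G ∪ ⁅ x ⁆) ((a , b) ∷ edges G)

join : ∀ {N} → Graph N → Graph N → Fin N → Fin N → Graph N
join G H a b = graph (verts G ∪ verts H) ((a , b) ∷ (edges G ++ edges H))

{-# OPTIONS --safe #-}
module Submission where

-- Sort the subtrees S ∈ 𝒮'(T) by which of v, w they contain.  Subtrees containing both
-- or neither are exactly the corresponding subtrees of T ⊙ e, with the same e(S) and d(S);
-- those containing neither lie in T₁ or in T₂ and are the subtrees of T₁′ or T₂′ avoiding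
-- the added vertex, and those containing v but not w are the subtrees of T₁′ of the same
-- kind (symmetrically for w and T₂′).  Adding a pendant vertex across vw turns a crossing
-- edge into an internal one, so S ↦ S ∪ {w} multiplies the weight by z/y; it matches the
-- subtrees of T ⊙ e containing only v with those of T containing both, and the subtrees of
-- T containing only v with those of T₁′ containing both (symmetrically, S ↦ S ∪ {v} for
-- T₂′).  A subtree containing a pendant vertex but not its neighbour is that leaf alone, so
-- it is not in 𝒮' and the remaining classes of T₁′, T₂′ and T ⊙ e are empty.  Comparing the
-- class sums gives (y + z) H̄_T = y (H̄_{T₁′} + H̄_{T₂′}) + z H̄_{T⊙e}.

open import Defs
open import Data.Nat using (ℕ)
open import Data.Fin using (Fin)
open import Data.Fin.Subset using (Subset; _∈_; _∉_)
open import Data.List using (List)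
open import Data.Rational using (ℚ; _+_; _*_; _÷_; NonZero)
open import Relation.Binary.PropositionalEquality using (_≡_)

open import Algebra.Bundles using (CommutativeMonoid)
open import Data.Bool using (Bool; true; false; not; _∧_; _xor_) renaming (T to True)
open import Data.Empty using (⊥-elim)
open import Data.Fin using (_≟_)
open import Data.Fin.Subset using (_⊆_; _∪_; _∩_; ⁅_⁆; Nonempty)
open import Data.Fin.Subset.Properties using (x∈p∪q⁻; x∈p∪q⁺; x∈p∩q⁺; x∈p∩q⁻; x∈⁅x⁆; x∈⁅y⁆⇒x≡y; _∈?_; nonempty?)
open import Data.List using ([]; _∷_; _++_; foldr; map; filter; length)
open import Data.List.Properties using (map-++; map-∘; map-cong-local; map-id; filter-++; filter-none; filter-accept; length-++; ++-identityʳ; foldr-map)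
open import Data.List.Membership.Propositional using () renaming (_∈_ to _∈ₗ_)
open import Data.List.Membership.Propositional.Properties using (∈-filter⁺; ∈-filter⁻; ∈-map⁺; ∈-map⁻; ∈-++⁺ˡ; ∈-++⁺ʳ; ∈-++⁻)
open import Data.List.Membership.Propositional.Properties.WithK using (unique∧set⇒bag)
open import Data.List.Relation.Binary.BagAndSetEquality using (∼bag⇒↭)
open import Data.List.Relation.Binary.Permutation.Propositional using (_↭_; ↭⇒↭ₛ; prep)
open import Data.List.Relation.Binary.Permutation.Propositional.Properties using (map⁺; ↭-length; filter-↭; ++-comm)
open import Data.List.Relation.Binary.Permutation.Setoid.Properties using (foldr-commMonoid)
open import Data.List.Relation.Unary.All as All using (All; []; _∷_; tabulate)
import Data.List.Relation.Unary.All.Properties as All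
open import Data.List.Relation.Unary.Any using (here; there)
open import Data.List.Relation.Unary.Unique.Propositional using (Unique)
import Data.List.Relation.Unary.Unique.Propositional.Properties as Unique
import Data.Nat as ℕ
open import Data.Nat.Properties using (m+n≡0⇒m≡0; m+n≡0⇒n≡0; suc-injective)
open import Data.Product using (_×_; _,_; proj₁; proj₂; ∃) renaming (swap to swap×)
open import Data.Rational using (0ℚ; 1ℚ; 1/_)
open import Data.Rational.Properties using (*-identityˡ; *-inverseˡ; *-assoc; +-0-isCommutativeMonoid; +-0-commutativeMonoid; +-assoc; +-identityʳ; *-zeroʳ; *-distribˡ-+)
open import Algebra.Properties.CommutativeSemigroup (CommutativeMonoid.commutativeSemigroup +-0-commutativeMonoid) using (x∙yz≈y∙xz)
open import Data.Rational.Solver using (module +-*-Solver)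
open import Data.Sum using (_⊎_; inj₁; inj₂; swap; [_,_])
open import Data.Sum.Function.Propositional using (_⊎-cong_)
import Data.Sum as Sum
open import Data.Vec using (lookup; _[_]≔_)
open import Data.Vec.Properties using ([]=⇒lookup; lookup⇒[]=; lookup∘update; lookup∘update′; []≔-idempotent; []≔-lookup)
open import Function using (_∘_; id)
open import Function.Bundles using (_⇔_; mk⇔; Equivalence)
open import Relation.Binary.PropositionalEquality using (refl; sym; trans; cong; cong₂; subst; subst₂; setoid; _≢_; module ≡-Reasoning)
open import Relation.Nullary using (¬_; Dec; does; yes; no)
open import Relation.Nullary.Decidable using (T?; _⊎-dec_; does-⇔)
open import Relation.Unary using (Pred; Decidable; ∁)
open import Relation.Unary.Properties using (∁?)

sumℚ : List ℚ → ℚ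
sumℚ = foldr _+_ 0ℚ

sumℚ-↭ : ∀ {xs ys} → xs ↭ ys → sumℚ xs ≡ sumℚ ys
sumℚ-↭ p = foldr-commMonoid (setoid ℚ) +-0-isCommutativeMonoid (↭⇒↭ₛ p)

sift : ∀ {a p q} {A : Set a} {P : Pred A p} {Q : Pred A q} → Decidable P → Decidable Q → List A → List A
sift P? Q? = filter Q? ∘ filter P?

count : ∀ {a p} {A : Set a} {P : Pred A p} → Decidable P → List A → ℕ
count P? = length ∘ filter P?

module _ {a} {A : Set a} where

  sumℚ-cong : ∀ {f g : A → ℚ} {xs} → All (λ x → f x ≡ g x) xs → sumℚ (map f xs) ≡ sumℚ (map g xs)
  sumℚ-cong = cong sumℚ ∘ map-cong-local

  sumℚ-scale : ∀ c (f : A → ℚ) xs → sumℚ (map (λ x → c * f x) xs) ≡ c * sumℚ (map f xs)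
  sumℚ-scale c f []       = sym (*-zeroʳ c)
  sumℚ-scale c f (x ∷ xs) = trans (cong (c * f x +_) (sumℚ-scale c f xs)) (sym (*-distribˡ-+ c (f x) _))

  sumℚ-partition : ∀ {p} {P : Pred A p} (P? : Decidable P) (f : A → ℚ) xs →
    sumℚ (map f xs) ≡ sumℚ (map f (filter P? xs)) + sumℚ (map f (filter (∁? P?) xs))
  sumℚ-partition P? f [] = sym (+-identityʳ 0ℚ)
  sumℚ-partition P? f (x ∷ xs) with P? x
  ... | yes _ = trans (cong (f x +_) (sumℚ-partition P? f xs)) (sym (+-assoc (f x) _ _))
  ... | no _  = trans (cong (f x +_) (sumℚ-partition P? f xs)) (x∙yz≈y∙xz (f x) (sumℚ (map f (filter P? xs))) _)

  sumℚ-bijection : ∀ {b} {B : Set b} {xs : List A} {ys : List B} (h : B → ℚ) (g : A → B) (g⁻¹ : B → A) →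
    Unique xs → Unique ys →
    (∀ {x} → x ∈ₗ xs → g x ∈ₗ ys × g⁻¹ (g x) ≡ x) →
    (∀ {y} → y ∈ₗ ys → g⁻¹ y ∈ₗ xs × g (g⁻¹ y) ≡ y) →
    sumℚ (map (h ∘ g) xs) ≡ sumℚ (map h ys)
  sumℚ-bijection {xs = xs} {ys} h g g⁻¹ !xs !ys forth back =
    trans (cong sumℚ (map-∘ xs))
          (sumℚ-↭ (map⁺ h (∼bag⇒↭ (unique∧set⇒bag !gxs !ys (mk⇔ gxs⊆ys ys⊆gxs)))))
    where
    g⁻¹∘g-xs : map g⁻¹ (map g xs) ≡ xs
    g⁻¹∘g-xs = trans (sym (map-∘ xs)) (trans (map-cong-local (tabulate (proj₂ ∘ forth))) (map-id xs))
    !gxs : Unique (map g xs)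
    !gxs = Unique.map⁻ (subst Unique (sym g⁻¹∘g-xs) !xs)
    gxs⊆ys : ∀ {y} → y ∈ₗ map g xs → y ∈ₗ ys
    gxs⊆ys y∈ with ∈-map⁻ g y∈
    ... | x , x∈ , refl = proj₁ (forth x∈)
    ys⊆gxs : ∀ {y} → y ∈ₗ ys → y ∈ₗ map g xs
    ys⊆gxs y∈ with back y∈
    ... | x∈ , eq = subst (_∈ₗ map g xs) eq (∈-map⁺ g x∈)

  sumℚ-same-members : ∀ {f g : A → ℚ} {xs ys} → Unique xs → Unique ys →
    (∀ {x} → x ∈ₗ xs → x ∈ₗ ys) → (∀ {x} → x ∈ₗ ys → x ∈ₗ xs) →
    (∀ {x} → x ∈ₗ xs → f x ≡ g x) → sumℚ (map f xs) ≡ sumℚ (map g ys)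
  sumℚ-same-members {g = g} !xs !ys xs⊆ys ys⊆xs f≗g =
    trans (sumℚ-cong (tabulate f≗g))
          (sumℚ-bijection g id id !xs !ys (λ x∈ → xs⊆ys x∈ , refl) (λ x∈ → ys⊆xs x∈ , refl))

  no-members : ∀ {xs : List A} → (∀ {x} → ¬ x ∈ₗ xs) → xs ≡ []
  no-members {[]}    _     = refl
  no-members {x ∷ _} empty = ⊥-elim (empty (here refl))

  module _ {p q} {P : Pred A p} {Q : Pred A q} (P? : Decidable P) (Q? : Decidable Q) where

    ∈-sift⁻ : ∀ {x xs} → x ∈ₗ sift P? Q? xs → x ∈ₗ xs × P x × Q x
    ∈-sift⁻ x∈ with ∈-filter⁻ Q? x∈
    ... | x∈′ , Qx with ∈-filter⁻ P? x∈′
    ...   | x∈xs , Px = x∈xs , Px , Qx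

    ∈-sift⁺ : ∀ {x xs} → x ∈ₗ xs → P x → Q x → x ∈ₗ sift P? Q? xs
    ∈-sift⁺ x∈ Px Qx = ∈-filter⁺ Q? (∈-filter⁺ P? x∈ Px) Qx

    sift-unique : ∀ {xs} → Unique xs → Unique (sift P? Q? xs)
    sift-unique = Unique.filter⁺ Q? ∘ Unique.filter⁺ P?

    sumℚ-sift : ∀ (f : A → ℚ) xs → sumℚ (map f xs) ≡
      (sumℚ (map f (sift P? Q? xs)) + sumℚ (map f (sift P? (∁? Q?) xs)))
      + (sumℚ (map f (sift (∁? P?) Q? xs)) + sumℚ (map f (sift (∁? P?) (∁? Q?) xs)))
    sumℚ-sift f xs = trans (sumℚ-partition P? f xs)
      (cong₂ _+_ (sumℚ-partition Q? f (filter P? xs)) (sumℚ-partition Q? f (filter (∁? P?) xs)))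

  module _ {p} {P : Pred A p} (P? : Decidable P) where

    count-++ : ∀ xs ys → count P? (xs ++ ys) ≡ count P? xs ℕ.+ count P? ys
    count-++ xs ys = trans (cong length (filter-++ P? xs ys)) (length-++ (filter P? xs))

    count-++-rejected : ∀ xs {ys} → All (∁ P) ys → count P? (xs ++ ys) ≡ count P? xs
    count-++-rejected xs ¬Pys = trans (cong length (filter-++ P? xs _))
      (cong length (trans (cong (filter P? xs ++_) (filter-none P? ¬Pys)) (++-identityʳ _)))

    count-↭ : ∀ {xs ys} → xs ↭ ys → count P? xs ≡ count P? ys
    count-↭ = ↭-length ∘ filter-↭ P?

    count-accept : ∀ {x} xs → P x → count P? (x ∷ xs) ≡ ℕ.suc (count P? xs)
    count-accept xs Px = cong length (filter-accept P? Px)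

    count-only : ∀ {x xs} → P x → All (∁ P) xs → count P? (x ∷ xs) ≡ 1
    count-only {xs = xs} Px ¬Pxs = trans (count-accept xs Px) (cong (ℕ.suc ∘ length) (filter-none P? ¬Pxs))

  count-map-cong : ∀ {b p q} {B : Set b} {P : Pred B p} {Q : Pred A q}
    (P? : Decidable P) (Q? : Decidable Q) (h : A → B) xs →
    (∀ {x} → x ∈ₗ xs → does (P? (h x)) ≡ does (Q? x)) → count P? (map h xs) ≡ count Q? xs
  count-map-cong P? Q? h [] _ = refl
  count-map-cong P? Q? h (x ∷ xs) agree with does (P? (h x)) | does (Q? x) | agree (here refl)
  ... | true  | true  | _ = cong ℕ.suc (count-map-cong P? Q? h xs (agree ∘ there))
  ... | false | false | _ = count-map-cong P? Q? h xs (agree ∘ there)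

-- Walks, vertex sets and subtrees

module _ {N : ℕ} {G : Graph N} {U : Subset N} where

  walk-source : ∀ {a b} → WalkIn G U a b → a ∈ U
  walk-source (here a∈) = a∈
  walk-source (step a∈ _ _) = a∈

  infixr 5 _◅◅_
  _◅◅_ : ∀ {a b c} → WalkIn G U a b → WalkIn G U b c → WalkIn G U a c
  here _       ◅◅ q = q
  step a∈ e p ◅◅ q = step a∈ e (p ◅◅ q)

  edge-walk : ∀ {a b} → a ∈ U → b ∈ U → Adj G a b → WalkIn G U a b
  edge-walk a∈ b∈ e = step a∈ e (here b∈)

  walk-reverse : ∀ {a b} → WalkIn G U a b → WalkIn G U b a
  walk-reverse (here a∈)     = here a∈
  walk-reverse (step a∈ e p) = walk-reverse p ◅◅ edge-walk (walk-source p) a∈ (swap e)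

  walk-invariant : ∀ {r} (R : Fin N → Set r) → (∀ {a b} → a ∈ U → b ∈ U → R a → Adj G a b → R b) →
    ∀ {a c} → WalkIn G U a c → R a → R c
  walk-invariant R preserve (here _)      Ra = Ra
  walk-invariant R preserve (step a∈ e p) Ra = walk-invariant R preserve p (preserve a∈ (walk-source p) Ra e)

walk-map : ∀ {N} {G G′ : Graph N} {U U′ : Subset N} (f : Fin N → Fin N) →
  (∀ {a} → a ∈ U → f a ∈ U′) → (∀ {a b} → a ∈ U → b ∈ U → Adj G a b → WalkIn G′ U′ (f a) (f b)) →
  ∀ {a c} → WalkIn G U a c → WalkIn G′ U′ (f a) (f c)
walk-map f f∈ step′ (here a∈)     = here (f∈ a∈)
walk-map f f∈ step′ (step a∈ e p) = step′ a∈ (walk-source p) e ◅◅ walk-map f f∈ step′ p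

HasInnerVertex : ∀ {N} → Graph N → Subset N → Set
HasInnerVertex G S = ∃ λ a → (a ∈ S) × ¬ IsLeaf G a

module _ {N : ℕ} where

  redirect : Fin N → Fin N → Fin N → Fin N
  redirect a b x with x ≟ a
  ... | yes _ = b
  ... | no _  = x

  redirect-other : ∀ {a b x} → x ≢ a → redirect a b x ≡ x
  redirect-other {a} {b} {x} x≢a with x ≟ a
  ... | yes x≡a = ⊥-elim (x≢a x≡a)
  ... | no _    = refl

  redirect-∈ : ∀ {a b x} {U : Subset N} → x ∈ U → (a ∈ U → b ∈ U) → redirect a b x ∈ U
  redirect-∈ {a} {b} {x} x∈ a∈⇒b∈ with x ≟ a
  ... | yes refl = a∈⇒b∈ x∈
  ... | no _     = x∈

  redirect-∈⁻ : ∀ {a b x} {U : Subset N} → redirect a b x ∈ U → (b ∈ U → a ∈ U) → x ∈ U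
  redirect-∈⁻ {a} {b} {x} rx∈ b∈⇒a∈ with x ≟ a
  ... | yes refl = b∈⇒a∈ rx∈
  ... | no _     = rx∈

  redirect-≢ : ∀ {a b} x → b ≢ a → redirect a b x ≢ a
  redirect-≢ {a} {b} x b≢a with x ≟ a
  ... | yes _   = b≢a
  ... | no x≢a  = x≢a

  ≡-redirect : ∀ {a b x y} → y ≢ a → y ≢ b → (y ≡ redirect a b x) ⇔ (y ≡ x)
  ≡-redirect {a} {b} {x} y≢a y≢b with x ≟ a
  ... | yes refl = mk⇔ (⊥-elim ∘ y≢b) (⊥-elim ∘ y≢a)
  ... | no _     = mk⇔ id id

  walk-to-redirect : ∀ {G : Graph N} {U a b x} → Adj G a b → x ∈ U → redirect a b x ∈ U →
    WalkIn G U x (redirect a b x)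
  walk-to-redirect {a = a} {x = x} a~b x∈ rx∈ with x ≟ a
  ... | yes refl = edge-walk x∈ rx∈ a~b
  ... | no _     = here x∈

  insert : Fin N → Subset N → Subset N
  insert u S = S [ u ]≔ true

  remove : Fin N → Subset N → Subset N
  remove u S = S [ u ]≔ false

  ∉⇒lookup≡false : ∀ {S : Subset N} {x} → x ∉ S → lookup S x ≡ false
  ∉⇒lookup≡false {S} {x} x∉ with lookup S x in eq
  ... | true  = ⊥-elim (x∉ (lookup⇒[]= x S eq))
  ... | false = refl

  lookup-transfer : ∀ {S : Subset N} {a b} → lookup S a ≡ lookup S b → a ∈ S → b ∈ S
  lookup-transfer {S} {b = b} same a∈ = lookup⇒[]= b S (trans (sym same) ([]=⇒lookup a∈))

  ∈-insert-self : ∀ u (S : Subset N) → u ∈ insert u S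
  ∈-insert-self u S = lookup⇒[]= u _ (lookup∘update u S true)

  lookup-insert-other : ∀ {u x} (S : Subset N) → x ≢ u → lookup (insert u S) x ≡ lookup S x
  lookup-insert-other S x≢u = lookup∘update′ x≢u S true

  lookup-remove-other : ∀ {u x} (S : Subset N) → x ≢ u → lookup (remove u S) x ≡ lookup S x
  lookup-remove-other S x≢u = lookup∘update′ x≢u S false

  ∈-insert⁺ : ∀ {u x} (S : Subset N) → x ∈ S → x ∈ insert u S
  ∈-insert⁺ {u} {x} S x∈ with x ≟ u
  ... | yes refl = ∈-insert-self u S
  ... | no x≢u   = lookup⇒[]= x _ (trans (lookup-insert-other S x≢u) ([]=⇒lookup x∈))

  ∈-insert⁻ : ∀ {u x} (S : Subset N) → x ∈ insert u S → x ≡ u ⊎ x ∈ S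
  ∈-insert⁻ {u} {x} S x∈ with x ≟ u
  ... | yes x≡u = inj₁ x≡u
  ... | no x≢u  = inj₂ (lookup⇒[]= x S (trans (sym (lookup-insert-other S x≢u)) ([]=⇒lookup x∈)))

  ∉-remove-self : ∀ u (S : Subset N) → u ∉ remove u S
  ∉-remove-self u S u∈ with trans (sym ([]=⇒lookup u∈)) (lookup∘update u S false)
  ... | ()

  ∈-remove⁺ : ∀ {u x} (S : Subset N) → x ∈ S → x ≢ u → x ∈ remove u S
  ∈-remove⁺ {x = x} S x∈ x≢u = lookup⇒[]= x _ (trans (lookup-remove-other S x≢u) ([]=⇒lookup x∈))

  ∈-remove⁻ : ∀ {u x} (S : Subset N) → x ∈ remove u S → x ∈ S × x ≢ u
  ∈-remove⁻ {u} {x} S x∈ with x ≟ u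
  ... | yes refl = ⊥-elim (∉-remove-self u S x∈)
  ... | no x≢u   = lookup⇒[]= x S (trans (sym (lookup-remove-other S x≢u)) ([]=⇒lookup x∈)) , x≢u

  insert-remove : ∀ {u} (S : Subset N) → u ∈ S → insert u (remove u S) ≡ S
  insert-remove {u} S u∈ =
    trans ([]≔-idempotent S u) (trans (cong (S [ u ]≔_) (sym ([]=⇒lookup u∈))) ([]≔-lookup S u))

  remove-insert : ∀ {u} (S : Subset N) → u ∉ S → remove u (insert u S) ≡ S
  remove-insert {u} S u∉ =
    trans ([]≔-idempotent S u) (trans (cong (S [ u ]≔_) (sym (∉⇒lookup≡false u∉))) ([]≔-lookup S u))

  p⊆q∪r∧p∩r=∅⇒p⊆q : ∀ {p q r : Subset N} → p ⊆ q ∪ r → ¬ Nonempty (p ∩ r) → p ⊆ q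
  p⊆q∪r∧p∩r=∅⇒p⊆q {q = q} {r} p⊆ p∩r=∅ x∈ with x∈p∪q⁻ q r (p⊆ x∈)
  ... | inj₁ x∈q = x∈q
  ... | inj₂ x∈r = ⊥-elim (p∩r=∅ (_ , x∈p∩q⁺ (x∈ , x∈r)))

  p⊆q∪⁅x⁆∧x∉p⇒p⊆q : ∀ {p q : Subset N} {x} → p ⊆ q ∪ ⁅ x ⁆ → x ∉ p → p ⊆ q
  p⊆q∪⁅x⁆∧x∉p⇒p⊆q {p} {q} {x} p⊆ x∉ y∈ with x∈p∪q⁻ q ⁅ x ⁆ (p⊆ y∈)
  ... | inj₁ y∈q = y∈q
  ... | inj₂ y∈x = ⊥-elim (x∉ (subst (_∈ p) (x∈⁅y⁆⇒x≡y x y∈x) y∈))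

incident? : ∀ {N} (x : Fin N) (e : Edge N) → Dec (x ≡ proj₁ e ⊎ x ≡ proj₂ e)
incident? x e = (x ≟ proj₁ e) ⊎-dec (x ≟ proj₂ e)

inner-transfer : ∀ {N} {G G′ : Graph N} {S} → (∀ {x} → x ∈ S → deg G x ≡ deg G′ x) →
  HasInnerVertex G S → HasInnerVertex G′ S
inner-transfer same-deg (x , x∈ , x-inner) = x , x∈ , x-inner ∘ trans (same-deg x∈)

not-incident : ∀ {N} {x : Fin N} {E : List (Edge N)} → (∀ {a b} → (a , b) ∈ₗ E → x ≢ a × x ≢ b) →
  All (∁ (λ e → x ≡ proj₁ e ⊎ x ≡ proj₂ e)) E
not-incident apart = tabulate λ e∈ → [ proj₁ (apart e∈) , proj₂ (apart e∈) ]

Pendant : ∀ {N} → Graph N → Fin N → Fin N → Set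
Pendant G u t = IsLeaf G u × (∀ {b} → Adj G u b → b ≡ t)

module _ {N : ℕ} {G : Graph N} where
  open IsSubtree

  subtree-transfer : ∀ {G′ : Graph N} {S} → S ⊆ verts G′ →
    (∀ {a b} → a ∈ S → b ∈ S → Adj G a b → WalkIn G′ S a b) → IsSubtree G S → IsSubtree G′ S
  subtree-transfer S⊆ step′ st = record
    { inside = S⊆ ; nonempty = nonempty st ; connected = λ a∈ b∈ → walk-map id id step′ (connected st a∈ b∈) }

  insert-pendant : ∀ {S u t} → u ∈ verts G → t ∈ S → Adj G u t → IsSubtree' G S → IsSubtree' G (insert u S)
  insert-pendant {S} {u} {t} u∈G t∈ u~t (st , x , x∈ , x-inner) =
    record { inside    = inside′
           ; nonempty  = u , ∈-insert-self u S
           ; connected = λ a∈ b∈ → to-t a∈ ◅◅ walk-reverse (to-t b∈) }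
    , x , ∈-insert⁺ S x∈ , x-inner
    where
    inside′ : insert u S ⊆ verts G
    inside′ x∈ with ∈-insert⁻ S x∈
    ... | inj₁ refl = u∈G
    ... | inj₂ x∈S  = inside st x∈S
    to-t : ∀ {a} → a ∈ insert u S → WalkIn G (insert u S) a t
    to-t a∈ with ∈-insert⁻ S a∈
    ... | inj₁ refl = edge-walk a∈ (∈-insert⁺ S t∈) u~t
    ... | inj₂ a∈S  = walk-map id (∈-insert⁺ S) (λ p∈ q∈ → edge-walk (∈-insert⁺ S p∈) (∈-insert⁺ S q∈))
                               (connected st a∈S t∈)

  remove-pendant : ∀ {S u t} → Pendant G u t → t ≢ u → t ∈ S → IsSubtree' G S → IsSubtree' G (remove u S)
  remove-pendant {S} {u} {t} (u-leaf , u-nbr) t≢u t∈ (st , x , x∈ , x-inner) =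
    record { inside = inside st ∘ proj₁ ∘ ∈-remove⁻ S ; nonempty = t , t∈′ ; connected = connected′ }
    , x , ∈-remove⁺ S x∈ x≢u , x-inner
    where
    x≢u : x ≢ u
    x≢u refl = x-inner u-leaf
    t∈′ : t ∈ remove u S
    t∈′ = ∈-remove⁺ S t∈ t≢u
    -- Walks in S are mapped into S without u by sending u to its only neighbour t.
    retract : ∀ {a} → a ∈ S → redirect u t a ∈ remove u S
    retract {a} a∈ with a ≟ u
    ... | yes _   = t∈′
    ... | no a≢u  = ∈-remove⁺ S a∈ a≢u
    retract-step : ∀ {a b} → a ∈ S → b ∈ S → Adj G a b →
      WalkIn G (remove u S) (redirect u t a) (redirect u t b)
    retract-step {a} {b} a∈ b∈ a~b with a ≟ u | b ≟ u
    ... | yes _    | yes _   = here t∈′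
    ... | yes refl | no b≢u  = subst (WalkIn G (remove u S) t) (sym (u-nbr a~b)) (here t∈′)
    ... | no a≢u   | yes refl = subst (λ c → WalkIn G (remove u S) c t) (sym (u-nbr (swap a~b))) (here t∈′)
    ... | no a≢u   | no b≢u  = edge-walk (∈-remove⁺ S a∈ a≢u) (∈-remove⁺ S b∈ b≢u) a~b
    connected′ : ∀ {a b} → a ∈ remove u S → b ∈ remove u S → WalkIn G (remove u S) a b
    connected′ a∈ b∈ with ∈-remove⁻ S a∈ | ∈-remove⁻ S b∈
    ... | a∈S , a≢u | b∈S , b≢u = subst₂ (WalkIn G (remove u S)) (redirect-other a≢u) (redirect-other b≢u)
      (walk-map (redirect u t) retract retract-step (IsSubtree.connected st a∈S b∈S))

  pendant-excluded : ∀ {S u t} → Pendant G u t → u ∈ S → t ∉ S → ¬ IsSubtree' G S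
  pendant-excluded {S} {u} {t} (u-leaf , u-nbr) u∈ t∉ (st , x , x∈ , x-inner) =
    x-inner (subst (IsLeaf G) (sym (walk-invariant (_≡ u) stuck (connected st u∈ x∈) refl)) u-leaf)
    where
    stuck : ∀ {a b} → a ∈ S → b ∈ S → a ≡ u → Adj G a b → b ≡ u
    stuck _ b∈ refl u~b = ⊥-elim (t∉ (subst (_∈ S) (u-nbr u~b) b∈))

-- Weights of subtrees

internal? : (p : Bool × Bool) → Dec (True (proj₁ p ∧ proj₂ p))
internal? p = T? (proj₁ p ∧ proj₂ p)

crossing? : (p : Bool × Bool) → Dec (True (proj₁ p xor proj₂ p))
crossing? p = T? (proj₁ p xor proj₂ p)

monomial : ℚ → ℚ → List (Bool × Bool) → ℚ
monomial y z ps = (y ^ℚ count crossing? ps) * (z ^ℚ count internal? ps)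

module _ (y z : ℚ) where

  private
    trade-z-for-y : ∀ a b → z * ((y * a) * b) ≡ y * (a * (z * b))
    trade-z-for-y = solve 4 (λ y z a b → z :* ((y :* a) :* b) := y :* (a :* (z :* b))) refl y z
      where open +-*-Solver

  monomial-↭ : ∀ {ps qs} → ps ↭ qs → monomial y z ps ≡ monomial y z qs
  monomial-↭ p = cong₂ (λ d e → (y ^ℚ d) * (z ^ℚ e)) (count-↭ crossing? p) (count-↭ internal? p)

  monomial-++-unseen : ∀ ps {qs} → All (_≡ (false , false)) qs → monomial y z (ps ++ qs) ≡ monomial y z ps
  monomial-++-unseen ps unseen = cong₂ (λ d e → (y ^ℚ d) * (z ^ℚ e))
    (count-++-rejected crossing? ps (All.map (λ { refl → λ () }) unseen))
    (count-++-rejected internal? ps (All.map (λ { refl → λ () }) unseen))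

  -- Adding the outer endpoint of a crossing edge to S makes that edge internal.
  monomial-grow : ∀ b ps → z * monomial y z ((b , not b) ∷ ps) ≡ y * monomial y z ((true , true) ∷ ps)
  monomial-grow true  ps = trade-z-for-y (y ^ℚ count crossing? ps) (z ^ℚ count internal? ps)
  monomial-grow false ps = trade-z-for-y (y ^ℚ count crossing? ps) (z ^ℚ count internal? ps)

module _ {N : ℕ} where

  -- e(S) and d(S) depend on S only through the membership of the endpoints of each edge.
  ends : Subset N → Edge N → Bool × Bool
  ends S e = inB S (proj₁ e) , inB S (proj₂ e)

  profile : Graph N → Subset N → List (Bool × Bool)
  profile G S = map (ends S) (edges G)

  weight : ℚ → ℚ → Graph N → Subset N → ℚ
  weight y z G S = (y ^ℚ dS G S) * (z ^ℚ eS G S)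

  Hbar≡sumℚ : ∀ G L y z → Hbar G L y z ≡ sumℚ (map (weight y z G) L)
  Hbar≡sumℚ G L y z = sym (foldr-map _+_ (weight y z G) 0ℚ L)

  weight≡monomial : ∀ y z G S → weight y z G S ≡ monomial y z (profile G S)
  weight≡monomial y z G S = cong₂ (λ d e → (y ^ℚ d) * (z ^ℚ e))
    (sym (count-map-cong crossing? (λ e → T? (inB S (proj₁ e) xor inB S (proj₂ e))) (ends S) (edges G) λ _ → refl))
    (sym (count-map-cong internal? (λ e → T? (inB S (proj₁ e) ∧ inB S (proj₂ e))) (ends S) (edges G) λ _ → refl))

  monomial-split : ∀ y z S (E E′ : List (Edge N)) → (∀ {a b} → (a , b) ∈ₗ E′ → a ∉ S × b ∉ S) →
    monomial y z (map (ends S) (E ++ E′)) ≡ monomial y z (map (ends S) E)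
  monomial-split y z S E E′ outside =
    trans (cong (monomial y z) (map-++ (ends S) E E′))
          (monomial-++-unseen y z (map (ends S) E) (All.map⁺ (tabulate unseen)))
    where
    unseen : ∀ {e} → e ∈ₗ E′ → ends S e ≡ (false , false)
    unseen e∈ = cong₂ _,_ (∉⇒lookup≡false (proj₁ (outside e∈))) (∉⇒lookup≡false (proj₂ (outside e∈)))

  ends-insert-away : ∀ {S u} (E : List (Edge N)) → (∀ {a b} → (a , b) ∈ₗ E → a ≢ u × b ≢ u) →
    map (ends (insert u S)) E ≡ map (ends S) E
  ends-insert-away {S} E away = map-cong-local (tabulate λ e∈ →
    cong₂ _,_ (lookup-insert-other S (proj₁ (away e∈))) (lookup-insert-other S (proj₂ (away e∈))))

  sumℚ-insert-shift : ∀ y z (f g : Subset N → ℚ) u {xs ys} → Unique xs → Unique ys →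
    (∀ {S} → S ∈ₗ xs → insert u S ∈ₗ ys × u ∉ S) →
    (∀ {S} → S ∈ₗ ys → remove u S ∈ₗ xs × u ∈ S) →
    (∀ {S} → S ∈ₗ xs → z * f S ≡ y * g (insert u S)) → z * sumℚ (map f xs) ≡ y * sumℚ (map g ys)
  sumℚ-insert-shift y z f g u {xs} {ys} !xs !ys forth back trade = begin
    z * sumℚ (map f xs)
      ≡⟨ sumℚ-scale z f xs ⟨
    sumℚ (map (λ S → z * f S) xs)
      ≡⟨ sumℚ-cong (tabulate trade) ⟩
    sumℚ (map ((λ S → y * g S) ∘ insert u) xs)
      ≡⟨ sumℚ-bijection (λ S → y * g S) (insert u) (remove u) !xs !ys forth′ back′ ⟩
    sumℚ (map (λ S → y * g S) ys)
      ≡⟨ sumℚ-scale y g ys ⟩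
    y * sumℚ (map g ys) ∎
    where
    open ≡-Reasoning
    forth′ : ∀ {S} → S ∈ₗ xs → insert u S ∈ₗ ys × remove u (insert u S) ≡ S
    forth′ {S} S∈ = proj₁ (forth S∈) , remove-insert S (proj₂ (forth S∈))
    back′ : ∀ {S} → S ∈ₗ ys → remove u S ∈ₗ xs × insert u (remove u S) ≡ S
    back′ {S} S∈ = proj₁ (back S∈) , insert-remove S (proj₂ (back S∈))

  enumerated : ∀ {G : Graph N} {X S} → Enumerates' G X → S ∈ₗ X → IsSubtree' G S
  enumerated {S = S} E = Equivalence.to (proj₂ E S)

  listed : ∀ {G : Graph N} {X S} → Enumerates' G X → IsSubtree' G S → S ∈ₗ X
  listed {S = S} E = Equivalence.from (proj₂ E S)

-- B, V, W, Nb + Na: weights of the subtrees of T containing both v and w, only v, only w,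
-- neither (Nb: those meeting T₂); B₁, B₂: subtrees of T₁′, T₂′ containing both;
-- V⊙: subtrees of T ⊙ e containing only v.
recurrence-algebra : ∀ (y z : ℚ) {H H₁ H₂ H⊙ B V W Nb Na B₁ B₂ V⊙ : ℚ} →
  H ≡ (B + V) + (W + (Nb + Na)) → H₁ ≡ (B₁ + V) + (0ℚ + Na) →
  H₂ ≡ (B₂ + 0ℚ) + (W + Nb) → H⊙ ≡ (B + V⊙) + (0ℚ + (Nb + Na)) →
  z * V ≡ y * B₁ → z * W ≡ y * B₂ → z * V⊙ ≡ y * B →
  (y + z) * H ≡ y * (H₁ + H₂) + z * H⊙
recurrence-algebra y z {B = B} {V} {W} {Nb} {Na} {B₁} {B₂} {V⊙} refl refl refl refl zV zW zV⊙ = begin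
  (y + z) * ((B + V) + (W + (Nb + Na)))
    ≡⟨ solve 7 (λ y z B V W Nb Na → (y :+ z) :* ((B :+ V) :+ (W :+ (Nb :+ Na))) :=
                  (z :* V :+ z :* W :+ y :* B) :+ (y :* (V :+ W :+ Nb :+ Na) :+ z :* (B :+ Nb :+ Na)))
                refl y z B V W Nb Na ⟩
  (z * V + z * W + y * B) + (y * (V + W + Nb + Na) + z * (B + Nb + Na))
    ≡⟨ cong (_+ (y * (V + W + Nb + Na) + z * (B + Nb + Na))) (cong₂ _+_ (cong₂ _+_ zV zW) (sym zV⊙)) ⟩
  (y * B₁ + y * B₂ + z * V⊙) + (y * (V + W + Nb + Na) + z * (B + Nb + Na))
    ≡⟨ solve 10 (λ y z B V W Nb Na B₁ B₂ V⊙ →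
                  (y :* B₁ :+ y :* B₂ :+ z :* V⊙) :+ (y :* (V :+ W :+ Nb :+ Na) :+ z :* (B :+ Nb :+ Na)) :=
                  y :* (((B₁ :+ V) :+ (con 0ℚ :+ Na)) :+ ((B₂ :+ con 0ℚ) :+ (W :+ Nb)))
                  :+ z :* ((B :+ V⊙) :+ (con 0ℚ :+ (Nb :+ Na))))
                refl y z B V W Nb Na B₁ B₂ V⊙ ⟩
  y * (((B₁ + V) + (0ℚ + Na)) + ((B₂ + 0ℚ) + (W + Nb))) + z * ((B + V⊙) + (0ℚ + (Nb + Na))) ∎
  where
  open ≡-Reasoning
  open +-*-Solver

divide-out : ∀ (y z : ℚ) .{{_ : NonZero (y + z)}} {a b c : ℚ} →
  (y + z) * a ≡ y * b + z * c → a ≡ (y ÷ (y + z)) * b + (z ÷ (y + z)) * c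
divide-out y z {a} {b} {c} scaled = begin
  a                                   ≡⟨ *-identityˡ a ⟨
  1ℚ * a                              ≡⟨ cong (_* a) (*-inverseˡ (y + z)) ⟨
  (1/ (y + z) * (y + z)) * a          ≡⟨ *-assoc (1/ (y + z)) (y + z) a ⟩
  1/ (y + z) * ((y + z) * a)          ≡⟨ cong (1/ (y + z) *_) scaled ⟩
  1/ (y + z) * (y * b + z * c)        ≡⟨ solve 5 (λ i y z b c → i :* (y :* b :+ z :* c) :=
                                                             (y :* i) :* b :+ (z :* i) :* c)
                                               refl (1/ (y + z)) y z b c ⟩
  (y ÷ (y + z)) * b + (z ÷ (y + z)) * c ∎
  where
  open ≡-Reasoning
  open +-*-Solver

module Bridge {N : ℕ} (T₁ T₂ : Graph N) (v w : Fin N) (simple₁ : IsSimple T₁) (simple₂ : IsSimple T₂)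
  (disjoint : ∀ x → x ∈ verts T₁ → x ∉ verts T₂) (v∈T₁ : v ∈ verts T₁) (w∈T₂ : w ∈ verts T₂)
  where

  T T₁′ T₂′ T⊙ : Graph N
  T   = join T₁ T₂ v w
  T₁′ = addEdge T₁ w v w
  T₂′ = addEdge T₂ v v w
  T⊙  = nearContract T v w

  V₁ V₂ : Subset N
  V₁ = verts T₁
  V₂ = verts T₂

  E₁ E₂ : List (Edge N)
  E₁ = edges T₁
  E₂ = edges T₂

  σ : Fin N → Fin N
  σ = redirect w v

  move : Edge N → Edge N
  move = reattach v w

  Balanced : Subset N → Set
  Balanced S = inB S v ≡ inB S w

  balanced-outside : ∀ {S} → v ∉ S → w ∉ S → Balanced S
  balanced-outside v∉ w∉ = trans (∉⇒lookup≡false v∉) (sym (∉⇒lookup≡false w∉))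

  balanced-inside : ∀ {S} → v ∈ S → w ∈ S → Balanced S
  balanced-inside v∈ w∈ = trans ([]=⇒lookup v∈) (sym ([]=⇒lookup w∈))

  V₁-V₂-apart : ∀ {x y} → x ∈ V₁ → y ∈ V₂ → x ≢ y
  V₁-V₂-apart x∈ y∈ refl = disjoint _ x∈ y∈

  v≢w : v ≢ w
  v≢w = V₁-V₂-apart v∈T₁ w∈T₂

  V₁∌w : ∀ {x} → x ∈ V₁ → x ≢ w
  V₁∌w x∈ = V₁-V₂-apart x∈ w∈T₂

  V₂∌v : ∀ {x} → x ∈ V₂ → x ≢ v
  V₂∌v x∈ = V₁-V₂-apart v∈T₁ x∈ ∘ sym

  endpoints₁ : ∀ {a b} → (a , b) ∈ₗ E₁ → a ∈ V₁ × b ∈ V₁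
  endpoints₁ = IsSimple.endpoints simple₁

  endpoints₂ : ∀ {a b} → (a , b) ∈ₗ E₂ → a ∈ V₂ × b ∈ V₂
  endpoints₂ = IsSimple.endpoints simple₂

  adj-endpoints₁ : ∀ {p q} → Adj T₁ p q → p ∈ V₁ × q ∈ V₁
  adj-endpoints₁ (inj₁ e) = endpoints₁ e
  adj-endpoints₁ (inj₂ e) = swap× (endpoints₁ e)

  adj-endpoints₂ : ∀ {p q} → Adj T₂ p q → p ∈ V₂ × q ∈ V₂
  adj-endpoints₂ (inj₁ e) = endpoints₂ e
  adj-endpoints₂ (inj₂ e) = swap× (endpoints₂ e)

  -- Edges and degrees

  data JoinEdge : Edge N → Set where
    bridge : JoinEdge (v , w)
    left   : ∀ {e} → e ∈ₗ E₁ → JoinEdge e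
    right  : ∀ {e} → e ∈ₗ E₂ → JoinEdge e

  join-edge : ∀ {e} → e ∈ₗ edges T → JoinEdge e
  join-edge (here refl) = bridge
  join-edge (there e∈) with ∈-++⁻ E₁ e∈
  ... | inj₁ e∈₁ = left e∈₁
  ... | inj₂ e∈₂ = right e∈₂

  data JoinAdj : Fin N → Fin N → Set where
    bridge  : JoinAdj v w
    bridge⁻ : JoinAdj w v
    left    : ∀ {p q} → Adj T₁ p q → JoinAdj p q
    right   : ∀ {p q} → Adj T₂ p q → JoinAdj p q

  join-adj : ∀ {p q} → Adj T p q → JoinAdj p q
  join-adj (inj₁ e) with join-edge e
  ... | bridge   = bridge
  ... | left e₁  = left (inj₁ e₁)
  ... | right e₂ = right (inj₁ e₂)
  join-adj (inj₂ e) with join-edge e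
  ... | bridge   = bridge⁻
  ... | left e₁  = left (inj₂ e₁)
  ... | right e₂ = right (inj₂ e₂)

  join-bridge : Adj T v w
  join-bridge = inj₁ (here refl)

  T₁′⊆T : ∀ {p q} → Adj T₁′ p q → Adj T p q
  T₁′⊆T = Sum.map extend extend
    where extend : ∀ {e} → e ∈ₗ edges T₁′ → e ∈ₗ edges T
          extend (here refl) = here refl
          extend (there e∈)  = there (∈-++⁺ˡ e∈)

  T₂′⊆T : ∀ {p q} → Adj T₂′ p q → Adj T p q
  T₂′⊆T = Sum.map extend extend
    where extend : ∀ {e} → e ∈ₗ edges T₂′ → e ∈ₗ edges T
          extend (here refl) = here refl
          extend (there e∈)  = there (∈-++⁺ʳ E₁ e∈)

  move-bridge : move (v , w) ≡ (v , w)
  move-bridge with v ≟ w | w ≟ v | w ≟ w | v ≟ v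
  ... | yes v≡w | _       | _       | _       = ⊥-elim (v≢w v≡w)
  ... | no _    | yes w≡v | _       | _       = ⊥-elim (v≢w (sym w≡v))
  ... | no _    | no _    | no w≢w  | _       = ⊥-elim (w≢w refl)
  ... | no _    | no _    | yes _   | no v≢v  = ⊥-elim (v≢v refl)
  ... | no _    | no _    | yes _   | yes _   = refl

  move-left : ∀ {a b} → (a , b) ∈ₗ E₁ → move (a , b) ≡ (a , b)
  move-left {a} {b} e∈ with a ≟ w | b ≟ v | b ≟ w | a ≟ v
  ... | yes a≡w | _ | _       | _ = ⊥-elim (V₁∌w (proj₁ (endpoints₁ e∈)) a≡w)
  ... | no _    | _ | yes b≡w | _ = ⊥-elim (V₁∌w (proj₂ (endpoints₁ e∈)) b≡w)
  ... | no _    | _ | no _    | _ = refl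

  move-right : ∀ {a b} → (a , b) ∈ₗ E₂ → move (a , b) ≡ (σ a , σ b)
  move-right {a} {b} e∈ with a ≟ w | b ≟ v | b ≟ w | a ≟ v
  ... | _       | _       | _       | yes a≡v = ⊥-elim (V₂∌v (proj₁ (endpoints₂ e∈)) a≡v)
  ... | _       | yes b≡v | _       | _       = ⊥-elim (V₂∌v (proj₂ (endpoints₂ e∈)) b≡v)
  ... | yes a≡w | no _    | yes b≡w | no _    = ⊥-elim (IsSimple.noLoops simple₂ e∈ (trans a≡w (sym b≡w)))
  ... | yes _   | no _    | no _    | no _    = refl
  ... | no _    | no _    | yes _   | no _    = refl
  ... | no _    | no _    | no _    | no _    = refl

  move-old : ∀ {a b} → (a , b) ∈ₗ E₁ ++ E₂ → move (a , b) ≡ (σ a , σ b)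
  move-old e∈ with ∈-++⁻ E₁ e∈
  ... | inj₁ e∈₁ = trans (move-left e∈₁) (sym (cong₂ _,_ (redirect-other (V₁∌w (proj₁ (endpoints₁ e∈₁))))
                                                         (redirect-other (V₁∌w (proj₂ (endpoints₁ e∈₁))))))
  ... | inj₂ e∈₂ = move-right e∈₂

  contract-bridge : Adj T⊙ v w
  contract-bridge = inj₁ (subst (_∈ₗ edges T⊙) move-bridge (∈-map⁺ move (here refl)))

  contract-old : ∀ {a b} → (a , b) ∈ₗ E₁ ++ E₂ → (σ a , σ b) ∈ₗ edges T⊙
  contract-old e∈ = subst (_∈ₗ edges T⊙) (move-old e∈) (∈-map⁺ move (there e∈))

  contract-left : ∀ {p q} → Adj T₁ p q → Adj T⊙ (σ p) (σ q)
  contract-left = Sum.map (contract-old ∘ ∈-++⁺ˡ) (contract-old ∘ ∈-++⁺ˡ)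

  contract-right : ∀ {p q} → Adj T₂ p q → Adj T⊙ (σ p) (σ q)
  contract-right = Sum.map (contract-old ∘ ∈-++⁺ʳ E₁) (contract-old ∘ ∈-++⁺ʳ E₁)

  contract-edge : ∀ {e} → e ∈ₗ edges T⊙ →
    e ≡ (v , w) ⊎ ∃ λ e′ → e′ ∈ₗ E₁ ++ E₂ × e ≡ (σ (proj₁ e′) , σ (proj₂ e′))
  contract-edge e∈ with ∈-map⁻ move e∈
  ... | _  , here refl , refl = inj₁ move-bridge
  ... | e′ , there e′∈ , refl = inj₂ (e′ , e′∈ , move-old e′∈)

  -- Equations rather than indices, since matching would have to unify vertices with σ-images.
  data ContractAdj (p q : Fin N) : Set where
    bridge  : p ≡ v → q ≡ w → ContractAdj p q
    bridge⁻ : p ≡ w → q ≡ v → ContractAdj p q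
    moved   : ∀ {a b} → Adj T a b → p ≡ σ a → q ≡ σ b → ContractAdj p q

  contract-adj : ∀ {p q} → Adj T⊙ p q → ContractAdj p q
  contract-adj (inj₁ e) with contract-edge e
  ... | inj₁ refl               = bridge refl refl
  ... | inj₂ (_ , e′∈ , refl)   = moved (inj₁ (there e′∈)) refl refl
  contract-adj (inj₂ e) with contract-edge e
  ... | inj₁ refl               = bridge⁻ refl refl
  ... | inj₂ (_ , e′∈ , refl)   = moved (inj₂ (there e′∈)) refl refl

  σ-∈ : ∀ {U x} → Balanced U → x ∈ U → σ x ∈ U
  σ-∈ balanced x∈ = redirect-∈ x∈ (lookup-transfer (sym balanced))

  contract-detour : ∀ {U} → Balanced U → ∀ {p q} → p ∈ U → q ∈ U → Adj T⊙ (σ p) (σ q) →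
    WalkIn T⊙ U p q
  contract-detour balanced p∈ q∈ σp~σq =
    walk-to-redirect w~v p∈ (σ-∈ balanced p∈) ◅◅ edge-walk (σ-∈ balanced p∈) (σ-∈ balanced q∈) σp~σq
    ◅◅ walk-reverse (walk-to-redirect w~v q∈ (σ-∈ balanced q∈))
    where
    w~v : Adj T⊙ w v
    w~v = swap contract-bridge

  join→contract-step : ∀ {U} → Balanced U → ∀ {p q} → p ∈ U → q ∈ U → Adj T p q → WalkIn T⊙ U p q
  join→contract-step balanced p∈ q∈ p~q with join-adj p~q
  ... | bridge  = edge-walk p∈ q∈ contract-bridge
  ... | bridge⁻ = edge-walk p∈ q∈ (swap contract-bridge)
  ... | left e  = contract-detour balanced p∈ q∈ (contract-left e)
  ... | right e = contract-detour balanced p∈ q∈ (contract-right e)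

  contract→join-step : ∀ {U} → Balanced U → ∀ {p q} → p ∈ U → q ∈ U → Adj T⊙ p q → WalkIn T U p q
  contract→join-step {U} balanced p∈ q∈ p~q with contract-adj p~q
  ... | bridge refl refl  = edge-walk p∈ q∈ join-bridge
  ... | bridge⁻ refl refl = edge-walk p∈ q∈ (swap join-bridge)
  ... | moved a~b refl refl =
    walk-reverse (walk-to-redirect w~v (unσ p∈) p∈) ◅◅ edge-walk (unσ p∈) (unσ q∈) a~b
    ◅◅ walk-to-redirect w~v (unσ q∈) q∈
    where
    w~v : Adj T w v
    w~v = swap join-bridge
    unσ : ∀ {x} → σ x ∈ U → x ∈ U
    unσ σx∈ = redirect-∈⁻ σx∈ (lookup-transfer balanced)

  E₂-apart-from : ∀ {x} → x ∈ V₁ → ∀ {a b} → (a , b) ∈ₗ E₂ → x ≢ a × x ≢ b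
  E₂-apart-from x∈ e∈ =
    V₁-V₂-apart x∈ (proj₁ (endpoints₂ e∈)) , V₁-V₂-apart x∈ (proj₂ (endpoints₂ e∈))

  E₁-apart-from : ∀ {x} → x ∈ V₂ → ∀ {a b} → (a , b) ∈ₗ E₁ → x ≢ a × x ≢ b
  E₁-apart-from x∈ e∈ =
    V₁-V₂-apart (proj₁ (endpoints₁ e∈)) x∈ ∘ sym , V₁-V₂-apart (proj₂ (endpoints₁ e∈)) x∈ ∘ sym

  deg-left : ∀ {x} → x ∈ V₁ → deg T x ≡ deg T₁′ x
  deg-left {x} x∈ = count-++-rejected (incident? x) ((v , w) ∷ E₁) (not-incident (E₂-apart-from x∈))

  deg-right : ∀ {x} → x ∈ V₂ → deg T x ≡ deg T₂′ x
  deg-right {x} x∈ = trans (count-↭ (incident? x) (prep (v , w) (++-comm E₁ E₂)))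
                           (count-++-rejected (incident? x) ((v , w) ∷ E₂) (not-incident (E₁-apart-from x∈)))

  deg-contract : ∀ {x} → x ≢ v → x ≢ w → deg T⊙ x ≡ deg T x
  deg-contract {x} x≢v x≢w = count-map-cong (incident? x) (incident? x) move (edges T) agree
    where
    agree : ∀ {e} → e ∈ₗ edges T → does (incident? x (move e)) ≡ does (incident? x e)
    agree (here refl) = cong (does ∘ incident? x) move-bridge
    agree (there e∈)  = trans (cong (does ∘ incident? x) (move-old e∈))
      (does-⇔ (≡-redirect x≢w x≢v ⊎-cong ≡-redirect x≢w x≢v) (incident? x _) (incident? x _))

  deg-join-v : deg T v ≡ ℕ.suc (count (incident? v) E₁)
  deg-join-v = trans (count-++-rejected (incident? v) ((v , w) ∷ E₁) (not-incident (E₂-apart-from v∈T₁)))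
                     (count-accept (incident? v) E₁ (inj₁ refl))

  deg-join-w : deg T w ≡ ℕ.suc (count (incident? w) E₂)
  deg-join-w = trans (deg-right w∈T₂) (count-accept (incident? w) E₂ (inj₂ refl))

  v≡σ⇔w≡ : ∀ {a} → a ≢ v → (v ≡ σ a) ⇔ (w ≡ a)
  v≡σ⇔w≡ {a} a≢v with a ≟ w
  ... | yes refl = mk⇔ (λ _ → refl) (λ _ → refl)
  ... | no a≢w   = mk⇔ (⊥-elim ∘ a≢v ∘ sym) (⊥-elim ∘ a≢w ∘ sym)

  deg-contract-v : deg T⊙ v ≡ ℕ.suc (count (incident? v) E₁ ℕ.+ count (incident? w) E₂)
  deg-contract-v = begin
    deg T⊙ v
      ≡⟨ count-accept (incident? v) (map move (E₁ ++ E₂)) (inj₁ (cong proj₁ (sym move-bridge))) ⟩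
    ℕ.suc (count (incident? v) (map move (E₁ ++ E₂)))
      ≡⟨ cong (ℕ.suc ∘ count (incident? v)) (map-++ move E₁ E₂) ⟩
    ℕ.suc (count (incident? v) (map move E₁ ++ map move E₂))
      ≡⟨ cong ℕ.suc (count-++ (incident? v) (map move E₁) (map move E₂)) ⟩
    ℕ.suc (count (incident? v) (map move E₁) ℕ.+ count (incident? v) (map move E₂))
      ≡⟨ cong ℕ.suc (cong₂ ℕ._+_ (count-map-cong (incident? v) (incident? v) move E₁ unmoved)
                                 (count-map-cong (incident? v) (incident? w) move E₂ moved-to-v)) ⟩
    ℕ.suc (count (incident? v) E₁ ℕ.+ count (incident? w) E₂) ∎
    where
    open ≡-Reasoning
    unmoved : ∀ {e} → e ∈ₗ E₁ → does (incident? v (move e)) ≡ does (incident? v e)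
    unmoved e∈ = cong (does ∘ incident? v) (move-left e∈)
    moved-to-v : ∀ {e} → e ∈ₗ E₂ → does (incident? v (move e)) ≡ does (incident? w e)
    moved-to-v e∈ = trans (cong (does ∘ incident? v) (move-right e∈))
      (does-⇔ (v≡σ⇔w≡ (V₂∌v (proj₁ (endpoints₂ e∈))) ⊎-cong v≡σ⇔w≡ (V₂∌v (proj₂ (endpoints₂ e∈))))
              (incident? v _) (incident? w _))

  contract-leaf-v : IsLeaf T⊙ v ⇔ (IsLeaf T v × IsLeaf T w)
  contract-leaf-v = mk⇔ split merge
    where
    m n : ℕ
    m = count (incident? v) E₁
    n = count (incident? w) E₂
    split : IsLeaf T⊙ v → IsLeaf T v × IsLeaf T w
    split leaf = trans deg-join-v (cong ℕ.suc (m+n≡0⇒m≡0 m m+n≡0))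
               , trans deg-join-w (cong ℕ.suc (m+n≡0⇒n≡0 m m+n≡0))
      where
      m+n≡0 : m ℕ.+ n ≡ 0
      m+n≡0 = suc-injective (trans (sym deg-contract-v) leaf)
    merge : IsLeaf T v × IsLeaf T w → IsLeaf T⊙ v
    merge (v-leaf , w-leaf) = trans deg-contract-v (cong ℕ.suc (cong₂ ℕ._+_ m≡0 n≡0))
      where
      m≡0 : m ≡ 0
      m≡0 = suc-injective (trans (sym deg-join-v) v-leaf)
      n≡0 : n ≡ 0
      n≡0 = suc-injective (trans (sym deg-join-w) w-leaf)

  contract-inner-v : ¬ IsLeaf T⊙ v → ¬ IsLeaf T v ⊎ ¬ IsLeaf T w
  contract-inner-v v-inner with deg T v ℕ.≟ 1
  ... | yes v-leaf = inj₂ λ w-leaf → v-inner (Equivalence.from contract-leaf-v (v-leaf , w-leaf))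
  ... | no v-inner′ = inj₁ v-inner′

  pendant-left : Pendant T₁′ w v
  pendant-left = count-only (incident? w) (inj₂ refl) (not-incident (E₁-apart-from w∈T₂)) , neighbour
    where
    neighbour : ∀ {b} → Adj T₁′ w b → b ≡ v
    neighbour (inj₁ (here eq))  = ⊥-elim (v≢w (sym (cong proj₁ eq)))
    neighbour (inj₁ (there e∈)) = ⊥-elim (V₁∌w (proj₁ (endpoints₁ e∈)) refl)
    neighbour (inj₂ (here eq))  = cong proj₁ eq
    neighbour (inj₂ (there e∈)) = ⊥-elim (V₁∌w (proj₂ (endpoints₁ e∈)) refl)

  pendant-right : Pendant T₂′ v w
  pendant-right = count-only (incident? v) (inj₁ refl) (not-incident (E₂-apart-from v∈T₁)) , neighbour
    where
    neighbour : ∀ {b} → Adj T₂′ v b → b ≡ w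
    neighbour (inj₁ (here eq))  = cong proj₂ eq
    neighbour (inj₁ (there e∈)) = ⊥-elim (V₂∌v (proj₁ (endpoints₂ e∈)) refl)
    neighbour (inj₂ (here eq))  = ⊥-elim (v≢w (cong proj₂ eq))
    neighbour (inj₂ (there e∈)) = ⊥-elim (V₂∌v (proj₂ (endpoints₂ e∈)) refl)

  pendant-contract : Pendant T⊙ w v
  pendant-contract =
    count-only (incident? w) (inj₂ (cong proj₂ (sym move-bridge))) (All.map⁺ (tabulate moved-off-w)) , neighbour
    where
    σ≢w : ∀ x → σ x ≢ w
    σ≢w x = redirect-≢ x v≢w
    moved-off-w : ∀ {e} → e ∈ₗ E₁ ++ E₂ → ¬ (w ≡ proj₁ (move e) ⊎ w ≡ proj₂ (move e))
    moved-off-w {a , b} e∈ rewrite move-old e∈ = [ σ≢w a ∘ sym , σ≢w b ∘ sym ]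
    neighbour : ∀ {b} → Adj T⊙ w b → b ≡ v
    neighbour w~b with contract-adj w~b
    ... | bridge w≡v _         = ⊥-elim (v≢w (sym w≡v))
    ... | bridge⁻ _ b≡v        = b≡v
    ... | moved {a} _ w≡σa _   = ⊥-elim (σ≢w a (sym w≡σa))

  -- Corresponding subtrees

  within-left : ∀ {p q} → p ∈ V₁ → q ∈ V₁ → Adj T p q → Adj T₁ p q
  within-left p∈ q∈ p~q with join-adj p~q
  ... | bridge  = ⊥-elim (V₁∌w q∈ refl)
  ... | bridge⁻ = ⊥-elim (V₁∌w p∈ refl)
  ... | left e  = e
  ... | right e = ⊥-elim (V₁-V₂-apart p∈ (proj₁ (adj-endpoints₂ e)) refl)

  within-right : ∀ {p q} → p ∈ V₂ → q ∈ V₂ → Adj T p q → Adj T₂ p q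
  within-right p∈ q∈ p~q with join-adj p~q
  ... | bridge  = ⊥-elim (V₂∌v p∈ refl)
  ... | bridge⁻ = ⊥-elim (V₂∌v q∈ refl)
  ... | left e  = ⊥-elim (V₁-V₂-apart (proj₁ (adj-endpoints₁ e)) p∈ refl)
  ... | right e = e

  confined-left : ∀ {S x} → IsSubtree T S → w ∉ S → x ∈ S → x ∈ V₁ → S ⊆ V₁
  confined-left {S} st w∉ x∈ x∈₁ y∈ = walk-invariant (_∈ V₁) stays (IsSubtree.connected st x∈ y∈) x∈₁
    where
    stays : ∀ {a b} → a ∈ S → b ∈ S → a ∈ V₁ → Adj T a b → b ∈ V₁
    stays _ b∈ a∈₁ a~b with join-adj a~b
    ... | bridge  = ⊥-elim (w∉ b∈)
    ... | bridge⁻ = ⊥-elim (V₁∌w a∈₁ refl)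
    ... | left e  = proj₂ (adj-endpoints₁ e)
    ... | right e = ⊥-elim (V₁-V₂-apart a∈₁ (proj₁ (adj-endpoints₂ e)) refl)

  confined-right : ∀ {S x} → IsSubtree T S → v ∉ S → x ∈ S → x ∈ V₂ → S ⊆ V₂
  confined-right {S} st v∉ x∈ x∈₂ y∈ = walk-invariant (_∈ V₂) stays (IsSubtree.connected st x∈ y∈) x∈₂
    where
    stays : ∀ {a b} → a ∈ S → b ∈ S → a ∈ V₂ → Adj T a b → b ∈ V₂
    stays _ b∈ a∈₂ a~b with join-adj a~b
    ... | bridge  = ⊥-elim (V₂∌v a∈₂ refl)
    ... | bridge⁻ = ⊥-elim (v∉ b∈)
    ... | left e  = ⊥-elim (V₁-V₂-apart (proj₁ (adj-endpoints₁ e)) a∈₂ refl)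
    ... | right e = proj₂ (adj-endpoints₂ e)

  left-subtree : ∀ {S} → S ⊆ V₁ → IsSubtree' T S → IsSubtree' T₁′ S
  left-subtree S⊆V₁ (st , inner) =
    subtree-transfer (λ x∈ → x∈p∪q⁺ (inj₁ (S⊆V₁ x∈)))
      (λ p∈ q∈ p~q → edge-walk p∈ q∈ (Sum.map there there (within-left (S⊆V₁ p∈) (S⊆V₁ q∈) p~q))) st
    , inner-transfer {G = T} {G′ = T₁′} (λ x∈ → deg-left (S⊆V₁ x∈)) inner

  right-subtree : ∀ {S} → S ⊆ V₂ → IsSubtree' T S → IsSubtree' T₂′ S
  right-subtree S⊆V₂ (st , inner) =
    subtree-transfer (λ x∈ → x∈p∪q⁺ (inj₁ (S⊆V₂ x∈)))
      (λ p∈ q∈ p~q → edge-walk p∈ q∈ (Sum.map there there (within-right (S⊆V₂ p∈) (S⊆V₂ q∈) p~q))) st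
    , inner-transfer {G = T} {G′ = T₂′} (λ x∈ → deg-right (S⊆V₂ x∈)) inner

  left-subtree⁻ : ∀ {S} → w ∉ S → IsSubtree' T₁′ S → IsSubtree' T S
  left-subtree⁻ {S} w∉ (st , inner) =
    subtree-transfer (λ x∈ → x∈p∪q⁺ (inj₁ (S⊆V₁ x∈))) (λ p∈ q∈ → edge-walk p∈ q∈ ∘ T₁′⊆T) st
    , inner-transfer {G = T₁′} {G′ = T} (λ x∈ → sym (deg-left (S⊆V₁ x∈))) inner
    where
    S⊆V₁ : S ⊆ V₁
    S⊆V₁ = p⊆q∪⁅x⁆∧x∉p⇒p⊆q (IsSubtree.inside st) w∉

  right-subtree⁻ : ∀ {S} → v ∉ S → IsSubtree' T₂′ S → IsSubtree' T S
  right-subtree⁻ {S} v∉ (st , inner) =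
    subtree-transfer (λ x∈ → x∈p∪q⁺ (inj₂ (S⊆V₂ x∈))) (λ p∈ q∈ → edge-walk p∈ q∈ ∘ T₂′⊆T) st
    , inner-transfer {G = T₂′} {G′ = T} (λ x∈ → sym (deg-right (S⊆V₂ x∈))) inner
    where
    S⊆V₂ : S ⊆ V₂
    S⊆V₂ = p⊆q∪⁅x⁆∧x∉p⇒p⊆q (IsSubtree.inside st) v∉

  trichotomy : ∀ x → x ≡ v ⊎ x ≡ w ⊎ x ≢ v × x ≢ w
  trichotomy x with x ≟ v | x ≟ w
  ... | yes x≡v | _       = inj₁ x≡v
  ... | no _    | yes x≡w = inj₂ (inj₁ x≡w)
  ... | no x≢v  | no x≢w  = inj₂ (inj₂ (x≢v , x≢w))

  contract-subtree : ∀ {S} → Balanced S → IsSubtree' T S → IsSubtree' T⊙ S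
  contract-subtree {S} balanced (st , x , x∈ , x-inner) =
    subtree-transfer (IsSubtree.inside st) (join→contract-step balanced) st , inner
    where
    inner : HasInnerVertex T⊙ S
    inner with trichotomy x
    ... | inj₁ refl               = v , x∈ , x-inner ∘ proj₁ ∘ Equivalence.to contract-leaf-v
    ... | inj₂ (inj₁ refl)        =
      v , lookup-transfer (sym balanced) x∈ , x-inner ∘ proj₂ ∘ Equivalence.to contract-leaf-v
    ... | inj₂ (inj₂ (x≢v , x≢w)) = x , x∈ , x-inner ∘ trans (sym (deg-contract x≢v x≢w))

  contract-subtree⁻ : ∀ {S} → Balanced S → IsSubtree' T⊙ S → IsSubtree' T S
  contract-subtree⁻ {S} balanced (st , x , x∈ , x-inner) =
    subtree-transfer (IsSubtree.inside st) (contract→join-step balanced) st , inner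
    where
    inner : HasInnerVertex T S
    inner with trichotomy x
    ... | inj₁ refl with contract-inner-v x-inner
    ...   | inj₁ v-inner = v , x∈ , v-inner
    ...   | inj₂ w-inner = w , lookup-transfer balanced x∈ , w-inner
    inner | inj₂ (inj₁ refl)        = ⊥-elim (x-inner (proj₁ pendant-contract))
    inner | inj₂ (inj₂ (x≢v , x≢w)) = x , x∈ , x-inner ∘ trans (deg-contract x≢v x≢w)

  -- Corresponding weights

  E₂-outside : ∀ {S} → S ⊆ V₁ → ∀ {a b} → (a , b) ∈ₗ E₂ → a ∉ S × b ∉ S
  E₂-outside S⊆V₁ e∈ =
    (λ a∈ → proj₁ (E₂-apart-from (S⊆V₁ a∈) e∈) refl) , (λ b∈ → proj₂ (E₂-apart-from (S⊆V₁ b∈) e∈) refl)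

  E₁-outside : ∀ {S} → S ⊆ V₂ → ∀ {a b} → (a , b) ∈ₗ E₁ → a ∉ S × b ∉ S
  E₁-outside S⊆V₂ e∈ =
    (λ a∈ → proj₁ (E₁-apart-from (S⊆V₂ a∈) e∈) refl) , (λ b∈ → proj₂ (E₁-apart-from (S⊆V₂ b∈) e∈) refl)

  profile-contract : ∀ {S S′} → (∀ x → inB S (σ x) ≡ inB S′ x) →
    profile T⊙ S ≡ ends S (v , w) ∷ map (ends S′) (E₁ ++ E₂)
  profile-contract {S} {S′} σ-agrees =
    cong₂ _∷_ (cong (ends S) move-bridge) (trans (sym (map-∘ (E₁ ++ E₂))) (map-cong-local (tabulate agree)))
    where
    agree : ∀ {e} → e ∈ₗ E₁ ++ E₂ → ends S (move e) ≡ ends S′ e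
    agree {a , b} e∈ = trans (cong (ends S) (move-old e∈)) (cong₂ _,_ (σ-agrees a) (σ-agrees b))

  σ-lookup-balanced : ∀ {S} → Balanced S → ∀ x → inB S (σ x) ≡ inB S x
  σ-lookup-balanced balanced x with x ≟ w
  ... | yes refl = balanced
  ... | no _     = refl

  σ-lookup-insert : ∀ {S} → v ∈ S → ∀ x → inB S (σ x) ≡ inB (insert w S) x
  σ-lookup-insert {S} v∈ x with x ≟ w
  ... | yes refl = trans ([]=⇒lookup v∈) (sym ([]=⇒lookup (∈-insert-self w S)))
  ... | no x≢w   = sym (lookup-insert-other S x≢w)

  module _ (y z : ℚ) where
    open ≡-Reasoning

    weight-contract : ∀ {S} → Balanced S → weight y z T⊙ S ≡ weight y z T S
    weight-contract {S} balanced = begin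
      weight y z T⊙ S
        ≡⟨ weight≡monomial y z T⊙ S ⟩
      monomial y z (profile T⊙ S)
        ≡⟨ cong (monomial y z) (profile-contract {S} {S} (σ-lookup-balanced {S} balanced)) ⟩
      monomial y z (profile T S)
        ≡⟨ weight≡monomial y z T S ⟨
      weight y z T S ∎

    weight-contract-grow : ∀ {S} → v ∈ S → w ∉ S → z * weight y z T⊙ S ≡ y * weight y z T (insert w S)
    weight-contract-grow {S} v∈ w∉ = begin
      z * weight y z T⊙ S
        ≡⟨ cong (z *_) (weight≡monomial y z T⊙ S) ⟩
      z * monomial y z (profile T⊙ S)
        ≡⟨ cong (λ ps → z * monomial y z ps) (profile-contract {S} {insert w S} (σ-lookup-insert v∈)) ⟩
      z * monomial y z (ends S (v , w) ∷ rest)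
        ≡⟨ cong (λ p → z * monomial y z (p ∷ rest)) (cong₂ _,_ ([]=⇒lookup v∈) (∉⇒lookup≡false w∉)) ⟩
      z * monomial y z ((true , false) ∷ rest)
        ≡⟨ monomial-grow y z true rest ⟩
      y * monomial y z ((true , true) ∷ rest)
        ≡⟨ cong (λ p → y * monomial y z (p ∷ rest)) (cong₂ _,_ v-bit w-bit) ⟨
      y * monomial y z (profile T (insert w S))
        ≡⟨ cong (y *_) (weight≡monomial y z T (insert w S)) ⟨
      y * weight y z T (insert w S) ∎
      where
      rest : List (Bool × Bool)
      rest = map (ends (insert w S)) (E₁ ++ E₂)
      v-bit : inB (insert w S) v ≡ true
      v-bit = []=⇒lookup (∈-insert⁺ S v∈)
      w-bit : inB (insert w S) w ≡ true
      w-bit = []=⇒lookup (∈-insert-self w S)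

    monomial-left : ∀ {S} → S ⊆ V₁ → monomial y z (profile T S) ≡ monomial y z (profile T₁′ S)
    monomial-left {S} S⊆V₁ = monomial-split y z S ((v , w) ∷ E₁) E₂ (E₂-outside S⊆V₁)

    monomial-right : ∀ {S} → S ⊆ V₂ → monomial y z (profile T S) ≡ monomial y z (profile T₂′ S)
    monomial-right {S} S⊆V₂ = trans (monomial-↭ y z (map⁺ (ends S) (prep (v , w) (++-comm E₁ E₂))))
                                    (monomial-split y z S ((v , w) ∷ E₂) E₁ (E₁-outside S⊆V₂))

    weight-left : ∀ {S} → S ⊆ V₁ → weight y z T S ≡ weight y z T₁′ S
    weight-left {S} S⊆V₁ =
      trans (weight≡monomial y z T S) (trans (monomial-left S⊆V₁) (sym (weight≡monomial y z T₁′ S)))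

    weight-right : ∀ {S} → S ⊆ V₂ → weight y z T S ≡ weight y z T₂′ S
    weight-right {S} S⊆V₂ =
      trans (weight≡monomial y z T S) (trans (monomial-right S⊆V₂) (sym (weight≡monomial y z T₂′ S)))

    weight-left-grow : ∀ {S} → S ⊆ V₁ → v ∈ S → w ∉ S →
      z * weight y z T S ≡ y * weight y z T₁′ (insert w S)
    weight-left-grow {S} S⊆V₁ v∈ w∉ = begin
      z * weight y z T S
        ≡⟨ cong (z *_) (trans (weight≡monomial y z T S) (monomial-left S⊆V₁)) ⟩
      z * monomial y z (ends S (v , w) ∷ rest)
        ≡⟨ cong (λ p → z * monomial y z (p ∷ rest)) (cong₂ _,_ ([]=⇒lookup v∈) (∉⇒lookup≡false w∉)) ⟩
      z * monomial y z ((true , false) ∷ rest)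
        ≡⟨ monomial-grow y z true rest ⟩
      y * monomial y z ((true , true) ∷ rest)
        ≡⟨ cong (λ ps → y * monomial y z ps)
                (cong₂ _∷_ (cong₂ _,_ v-bit w-bit) (ends-insert-away {S = S} E₁ w-free)) ⟨
      y * monomial y z (profile T₁′ (insert w S))
        ≡⟨ cong (y *_) (weight≡monomial y z T₁′ (insert w S)) ⟨
      y * weight y z T₁′ (insert w S) ∎
      where
      rest : List (Bool × Bool)
      rest = map (ends S) E₁
      v-bit : inB (insert w S) v ≡ true
      v-bit = []=⇒lookup (∈-insert⁺ S v∈)
      w-bit : inB (insert w S) w ≡ true
      w-bit = []=⇒lookup (∈-insert-self w S)
      w-free : ∀ {a b} → (a , b) ∈ₗ E₁ → a ≢ w × b ≢ w
      w-free e∈ = V₁∌w (proj₁ (endpoints₁ e∈)) , V₁∌w (proj₂ (endpoints₁ e∈))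

    weight-right-grow : ∀ {S} → S ⊆ V₂ → w ∈ S → v ∉ S →
      z * weight y z T S ≡ y * weight y z T₂′ (insert v S)
    weight-right-grow {S} S⊆V₂ w∈ v∉ = begin
      z * weight y z T S
        ≡⟨ cong (z *_) (trans (weight≡monomial y z T S) (monomial-right S⊆V₂)) ⟩
      z * monomial y z (ends S (v , w) ∷ rest)
        ≡⟨ cong (λ p → z * monomial y z (p ∷ rest)) (cong₂ _,_ (∉⇒lookup≡false v∉) ([]=⇒lookup w∈)) ⟩
      z * monomial y z ((false , true) ∷ rest)
        ≡⟨ monomial-grow y z false rest ⟩
      y * monomial y z ((true , true) ∷ rest)
        ≡⟨ cong (λ ps → y * monomial y z ps)
                (cong₂ _∷_ (cong₂ _,_ v-bit w-bit) (ends-insert-away {S = S} E₂ v-free)) ⟨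
      y * monomial y z (profile T₂′ (insert v S))
        ≡⟨ cong (y *_) (weight≡monomial y z T₂′ (insert v S)) ⟨
      y * weight y z T₂′ (insert v S) ∎
      where
      rest : List (Bool × Bool)
      rest = map (ends S) E₂
      v-bit : inB (insert v S) v ≡ true
      v-bit = []=⇒lookup (∈-insert-self v S)
      w-bit : inB (insert v S) w ≡ true
      w-bit = []=⇒lookup (∈-insert⁺ S w∈)
      v-free : ∀ {a b} → (a , b) ∈ₗ E₂ → a ≢ v × b ≢ v
      v-free e∈ = V₂∌v (proj₁ (endpoints₂ e∈)) , V₂∌v (proj₂ (endpoints₂ e∈))

  -- Classes of subtrees

  ∋v? : Decidable (v ∈_)
  ∋v? = v ∈?_

  ∋w? : Decidable (w ∈_)
  ∋w? = w ∈?_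

  both only-v only-w neither : List (Subset N) → List (Subset N)
  both    = sift ∋v? ∋w?
  only-v  = sift ∋v? (∁? ∋w?)
  only-w  = sift (∁? ∋v?) ∋w?
  neither = sift (∁? ∋v?) (∁? ∋w?)

  ∈-both⁻ : ∀ X {S} → S ∈ₗ both X → S ∈ₗ X × v ∈ S × w ∈ S
  ∈-both⁻ X = ∈-sift⁻ ∋v? ∋w?

  ∈-both⁺ : ∀ {S X} → S ∈ₗ X → v ∈ S → w ∈ S → S ∈ₗ both X
  ∈-both⁺ = ∈-sift⁺ ∋v? ∋w?

  ∈-only-v⁻ : ∀ X {S} → S ∈ₗ only-v X → S ∈ₗ X × v ∈ S × w ∉ S
  ∈-only-v⁻ X = ∈-sift⁻ ∋v? (∁? ∋w?)

  ∈-only-v⁺ : ∀ {S X} → S ∈ₗ X → v ∈ S → w ∉ S → S ∈ₗ only-v X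
  ∈-only-v⁺ = ∈-sift⁺ ∋v? (∁? ∋w?)

  ∈-only-w⁻ : ∀ X {S} → S ∈ₗ only-w X → S ∈ₗ X × v ∉ S × w ∈ S
  ∈-only-w⁻ X = ∈-sift⁻ (∁? ∋v?) ∋w?

  ∈-only-w⁺ : ∀ {S X} → S ∈ₗ X → v ∉ S → w ∈ S → S ∈ₗ only-w X
  ∈-only-w⁺ = ∈-sift⁺ (∁? ∋v?) ∋w?

  ∈-neither⁻ : ∀ X {S} → S ∈ₗ neither X → S ∈ₗ X × v ∉ S × w ∉ S
  ∈-neither⁻ X = ∈-sift⁻ (∁? ∋v?) (∁? ∋w?)

  ∈-neither⁺ : ∀ {S X} → S ∈ₗ X → v ∉ S → w ∉ S → S ∈ₗ neither X
  ∈-neither⁺ = ∈-sift⁺ (∁? ∋v?) (∁? ∋w?)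

  both-unique : ∀ {X} → Unique X → Unique (both X)
  both-unique = sift-unique ∋v? ∋w?

  only-v-unique : ∀ {X} → Unique X → Unique (only-v X)
  only-v-unique = sift-unique ∋v? (∁? ∋w?)

  only-w-unique : ∀ {X} → Unique X → Unique (only-w X)
  only-w-unique = sift-unique (∁? ∋v?) ∋w?

  neither-unique : ∀ {X} → Unique X → Unique (neither X)
  neither-unique = sift-unique (∁? ∋v?) (∁? ∋w?)

  meets-V₂? : Decidable (λ S → Nonempty (S ∩ V₂))
  meets-V₂? S = nonempty? (S ∩ V₂)

  module Decomposition (y z : ℚ) {L L₁ L₂ L⊙ : List (Subset N)}
    (enum : Enumerates' T L) (enum₁ : Enumerates' T₁′ L₁) (enum₂ : Enumerates' T₂′ L₂)
    (enum⊙ : Enumerates' T⊙ L⊙) where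

    H : Graph N → List (Subset N) → ℚ
    H G X = sumℚ (map (weight y z G) X)

    decompose : ∀ G X → Hbar G X y z ≡ (H G (both X) + H G (only-v X)) + (H G (only-w X) + H G (neither X))
    decompose G X = trans (Hbar≡sumℚ G X y z) (sumℚ-sift ∋v? ∋w? (weight y z G) X)

    neither-left : H T (filter (∁? meets-V₂?) (neither L)) ≡ H T₁′ (neither L₁)
    neither-left =
      sumℚ-same-members (Unique.filter⁺ (∁? meets-V₂?) (neither-unique (proj₁ enum))) (neither-unique (proj₁ enum₁))
      forth back (λ S∈ → weight-left y z (in-V₁ S∈))
      where
      in-V₁ : ∀ {S} → S ∈ₗ filter (∁? meets-V₂?) (neither L) → S ⊆ V₁
      in-V₁ S∈ with ∈-filter⁻ (∁? meets-V₂?) S∈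
      ... | S∈′ , misses =
        p⊆q∪r∧p∩r=∅⇒p⊆q (IsSubtree.inside (proj₁ (enumerated enum (proj₁ (∈-neither⁻ L S∈′))))) misses
      forth : ∀ {S} → S ∈ₗ filter (∁? meets-V₂?) (neither L) → S ∈ₗ neither L₁
      forth S∈ with ∈-neither⁻ L (proj₁ (∈-filter⁻ (∁? meets-V₂?) S∈))
      ... | S∈L , v∉ , w∉ = ∈-neither⁺ (listed enum₁ (left-subtree (in-V₁ S∈) (enumerated enum S∈L))) v∉ w∉
      back : ∀ {S} → S ∈ₗ neither L₁ → S ∈ₗ filter (∁? meets-V₂?) (neither L)
      back {S} S∈ with ∈-neither⁻ L₁ S∈
      ... | S∈L₁ , v∉ , w∉ = ∈-filter⁺ (∁? meets-V₂?) (∈-neither⁺ (listed enum (left-subtree⁻ w∉ sub)) v∉ w∉) misses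
        where
        sub : IsSubtree' T₁′ S
        sub = enumerated enum₁ S∈L₁
        misses : ¬ Nonempty (S ∩ V₂)
        misses (x , x∈) with x∈p∩q⁻ S V₂ x∈
        ... | x∈S , x∈₂ = V₁-V₂-apart (p⊆q∪⁅x⁆∧x∉p⇒p⊆q (IsSubtree.inside (proj₁ sub)) w∉ x∈S) x∈₂ refl

    neither-right : H T (filter meets-V₂? (neither L)) ≡ H T₂′ (neither L₂)
    neither-right =
      sumℚ-same-members (Unique.filter⁺ meets-V₂? (neither-unique (proj₁ enum))) (neither-unique (proj₁ enum₂))
      forth back (λ S∈ → weight-right y z (in-V₂ S∈))
      where
      in-V₂ : ∀ {S} → S ∈ₗ filter meets-V₂? (neither L) → S ⊆ V₂
      in-V₂ S∈ with ∈-filter⁻ meets-V₂? S∈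
      ... | S∈′ , (x , x∈) with ∈-neither⁻ L S∈′ | x∈p∩q⁻ _ V₂ x∈
      ...   | S∈L , v∉ , _ | x∈S , x∈₂ = confined-right (proj₁ (enumerated enum S∈L)) v∉ x∈S x∈₂
      forth : ∀ {S} → S ∈ₗ filter meets-V₂? (neither L) → S ∈ₗ neither L₂
      forth S∈ with ∈-neither⁻ L (proj₁ (∈-filter⁻ meets-V₂? S∈))
      ... | S∈L , v∉ , w∉ = ∈-neither⁺ (listed enum₂ (right-subtree (in-V₂ S∈) (enumerated enum S∈L))) v∉ w∉
      back : ∀ {S} → S ∈ₗ neither L₂ → S ∈ₗ filter meets-V₂? (neither L)
      back {S} S∈ with ∈-neither⁻ L₂ S∈
      ... | S∈L₂ , v∉ , w∉ = ∈-filter⁺ meets-V₂? (∈-neither⁺ (listed enum (right-subtree⁻ v∉ sub)) v∉ w∉) meets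
        where
        sub : IsSubtree' T₂′ S
        sub = enumerated enum₂ S∈L₂
        meets : Nonempty (S ∩ V₂)
        meets with IsSubtree.nonempty (proj₁ sub)
        ... | x , x∈S = x , x∈p∩q⁺ (x∈S , p⊆q∪⁅x⁆∧x∉p⇒p⊆q (IsSubtree.inside (proj₁ sub)) v∉ x∈S)

    neither-contract : H T (neither L) ≡ H T⊙ (neither L⊙)
    neither-contract =
      sumℚ-same-members (neither-unique (proj₁ enum)) (neither-unique (proj₁ enum⊙)) forth back same-weight
      where
      same-weight : ∀ {S} → S ∈ₗ neither L → weight y z T S ≡ weight y z T⊙ S
      same-weight {S} S∈ with ∈-neither⁻ L S∈
      ... | _ , v∉ , w∉ = sym (weight-contract y z {S} (balanced-outside v∉ w∉))
      forth : ∀ {S} → S ∈ₗ neither L → S ∈ₗ neither L⊙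
      forth S∈ with ∈-neither⁻ L S∈
      ... | S∈L , v∉ , w∉ =
        ∈-neither⁺ (listed enum⊙ (contract-subtree (balanced-outside v∉ w∉) (enumerated enum S∈L))) v∉ w∉
      back : ∀ {S} → S ∈ₗ neither L⊙ → S ∈ₗ neither L
      back S∈ with ∈-neither⁻ L⊙ S∈
      ... | S∈L⊙ , v∉ , w∉ =
        ∈-neither⁺ (listed enum (contract-subtree⁻ (balanced-outside v∉ w∉) (enumerated enum⊙ S∈L⊙))) v∉ w∉

    only-v-left : H T (only-v L) ≡ H T₁′ (only-v L₁)
    only-v-left = sumℚ-same-members (only-v-unique (proj₁ enum)) (only-v-unique (proj₁ enum₁))
      forth back (λ S∈ → weight-left y z (in-V₁ S∈))
      where
      in-V₁ : ∀ {S} → S ∈ₗ only-v L → S ⊆ V₁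
      in-V₁ S∈ with ∈-only-v⁻ L S∈
      ... | S∈L , v∈ , w∉ = confined-left (proj₁ (enumerated enum S∈L)) w∉ v∈ v∈T₁
      forth : ∀ {S} → S ∈ₗ only-v L → S ∈ₗ only-v L₁
      forth S∈ with ∈-only-v⁻ L S∈
      ... | S∈L , v∈ , w∉ = ∈-only-v⁺ (listed enum₁ (left-subtree (in-V₁ S∈) (enumerated enum S∈L))) v∈ w∉
      back : ∀ {S} → S ∈ₗ only-v L₁ → S ∈ₗ only-v L
      back S∈ with ∈-only-v⁻ L₁ S∈
      ... | S∈L₁ , v∈ , w∉ = ∈-only-v⁺ (listed enum (left-subtree⁻ w∉ (enumerated enum₁ S∈L₁))) v∈ w∉

    only-w-right : H T (only-w L) ≡ H T₂′ (only-w L₂)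
    only-w-right = sumℚ-same-members (only-w-unique (proj₁ enum)) (only-w-unique (proj₁ enum₂))
      forth back (λ S∈ → weight-right y z (in-V₂ S∈))
      where
      in-V₂ : ∀ {S} → S ∈ₗ only-w L → S ⊆ V₂
      in-V₂ S∈ with ∈-only-w⁻ L S∈
      ... | S∈L , v∉ , w∈ = confined-right (proj₁ (enumerated enum S∈L)) v∉ w∈ w∈T₂
      forth : ∀ {S} → S ∈ₗ only-w L → S ∈ₗ only-w L₂
      forth S∈ with ∈-only-w⁻ L S∈
      ... | S∈L , v∉ , w∈ = ∈-only-w⁺ (listed enum₂ (right-subtree (in-V₂ S∈) (enumerated enum S∈L))) v∉ w∈
      back : ∀ {S} → S ∈ₗ only-w L₂ → S ∈ₗ only-w L
      back S∈ with ∈-only-w⁻ L₂ S∈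
      ... | S∈L₂ , v∉ , w∈ = ∈-only-w⁺ (listed enum (right-subtree⁻ v∉ (enumerated enum₂ S∈L₂))) v∉ w∈

    both-contract : H T (both L) ≡ H T⊙ (both L⊙)
    both-contract = sumℚ-same-members (both-unique (proj₁ enum)) (both-unique (proj₁ enum⊙)) forth back same-weight
      where
      same-weight : ∀ {S} → S ∈ₗ both L → weight y z T S ≡ weight y z T⊙ S
      same-weight {S} S∈ with ∈-both⁻ L S∈
      ... | _ , v∈ , w∈ = sym (weight-contract y z {S} (balanced-inside v∈ w∈))
      forth : ∀ {S} → S ∈ₗ both L → S ∈ₗ both L⊙
      forth S∈ with ∈-both⁻ L S∈
      ... | S∈L , v∈ , w∈ =
        ∈-both⁺ (listed enum⊙ (contract-subtree (balanced-inside v∈ w∈) (enumerated enum S∈L))) v∈ w∈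
      back : ∀ {S} → S ∈ₗ both L⊙ → S ∈ₗ both L
      back S∈ with ∈-both⁻ L⊙ S∈
      ... | S∈L⊙ , v∈ , w∈ =
        ∈-both⁺ (listed enum (contract-subtree⁻ (balanced-inside v∈ w∈) (enumerated enum⊙ S∈L⊙))) v∈ w∈

    only-v-contract-grow : z * H T⊙ (only-v L⊙) ≡ y * H T (both L)
    only-v-contract-grow = sumℚ-insert-shift y z (weight y z T⊙) (weight y z T) w
      (only-v-unique (proj₁ enum⊙)) (both-unique (proj₁ enum)) forth back trade
      where
      forth : ∀ {S} → S ∈ₗ only-v L⊙ → insert w S ∈ₗ both L × w ∉ S
      forth {S} S∈ with ∈-only-v⁻ L⊙ S∈
      ... | S∈L⊙ , v∈ , w∉ = ∈-both⁺ (listed enum (contract-subtree⁻ (balanced-inside v∈′ w∈′) grown)) v∈′ w∈′ , w∉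
        where
        v∈′ : v ∈ insert w S
        v∈′ = ∈-insert⁺ S v∈
        w∈′ : w ∈ insert w S
        w∈′ = ∈-insert-self w S
        grown : IsSubtree' T⊙ (insert w S)
        grown = insert-pendant (x∈p∪q⁺ (inj₂ w∈T₂)) v∈ (swap contract-bridge) (enumerated enum⊙ S∈L⊙)
      back : ∀ {S} → S ∈ₗ both L → remove w S ∈ₗ only-v L⊙ × w ∈ S
      back {S} S∈ with ∈-both⁻ L S∈
      ... | S∈L , v∈ , w∈ = ∈-only-v⁺ (listed enum⊙ pruned) (∈-remove⁺ S v∈ v≢w) (∉-remove-self w S) , w∈
        where
        pruned : IsSubtree' T⊙ (remove w S)
        pruned = remove-pendant pendant-contract v≢w v∈ (contract-subtree (balanced-inside v∈ w∈) (enumerated enum S∈L))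
      trade : ∀ {S} → S ∈ₗ only-v L⊙ → z * weight y z T⊙ S ≡ y * weight y z T (insert w S)
      trade S∈ with ∈-only-v⁻ L⊙ S∈
      ... | _ , v∈ , w∉ = weight-contract-grow y z v∈ w∉

    only-v-left-grow : z * H T (only-v L) ≡ y * H T₁′ (both L₁)
    only-v-left-grow = sumℚ-insert-shift y z (weight y z T) (weight y z T₁′) w
      (only-v-unique (proj₁ enum)) (both-unique (proj₁ enum₁)) forth back trade
      where
      in-V₁ : ∀ {S} → S ∈ₗ only-v L → S ⊆ V₁
      in-V₁ S∈ with ∈-only-v⁻ L S∈
      ... | S∈L , v∈ , w∉ = confined-left (proj₁ (enumerated enum S∈L)) w∉ v∈ v∈T₁
      forth : ∀ {S} → S ∈ₗ only-v L → insert w S ∈ₗ both L₁ × w ∉ S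
      forth {S} S∈ with ∈-only-v⁻ L S∈
      ... | S∈L , v∈ , w∉ = ∈-both⁺ (listed enum₁ grown) (∈-insert⁺ S v∈) (∈-insert-self w S) , w∉
        where
        grown : IsSubtree' T₁′ (insert w S)
        grown = insert-pendant (x∈p∪q⁺ (inj₂ (x∈⁅x⁆ w))) v∈ (inj₂ (here refl)) (left-subtree (in-V₁ S∈) (enumerated enum S∈L))
      back : ∀ {S} → S ∈ₗ both L₁ → remove w S ∈ₗ only-v L × w ∈ S
      back {S} S∈ with ∈-both⁻ L₁ S∈
      ... | S∈L₁ , v∈ , w∈ =
        ∈-only-v⁺ (listed enum (left-subtree⁻ (∉-remove-self w S) pruned)) (∈-remove⁺ S v∈ v≢w) (∉-remove-self w S) , w∈
        where
        pruned : IsSubtree' T₁′ (remove w S)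
        pruned = remove-pendant pendant-left v≢w v∈ (enumerated enum₁ S∈L₁)
      trade : ∀ {S} → S ∈ₗ only-v L → z * weight y z T S ≡ y * weight y z T₁′ (insert w S)
      trade S∈ with ∈-only-v⁻ L S∈
      ... | _ , v∈ , w∉ = weight-left-grow y z (in-V₁ S∈) v∈ w∉

    only-w-right-grow : z * H T (only-w L) ≡ y * H T₂′ (both L₂)
    only-w-right-grow = sumℚ-insert-shift y z (weight y z T) (weight y z T₂′) v
      (only-w-unique (proj₁ enum)) (both-unique (proj₁ enum₂)) forth back trade
      where
      in-V₂ : ∀ {S} → S ∈ₗ only-w L → S ⊆ V₂
      in-V₂ S∈ with ∈-only-w⁻ L S∈
      ... | S∈L , v∉ , w∈ = confined-right (proj₁ (enumerated enum S∈L)) v∉ w∈ w∈T₂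
      forth : ∀ {S} → S ∈ₗ only-w L → insert v S ∈ₗ both L₂ × v ∉ S
      forth {S} S∈ with ∈-only-w⁻ L S∈
      ... | S∈L , v∉ , w∈ = ∈-both⁺ (listed enum₂ grown) (∈-insert-self v S) (∈-insert⁺ S w∈) , v∉
        where
        grown : IsSubtree' T₂′ (insert v S)
        grown = insert-pendant (x∈p∪q⁺ (inj₂ (x∈⁅x⁆ v))) w∈ (inj₁ (here refl)) (right-subtree (in-V₂ S∈) (enumerated enum S∈L))
      back : ∀ {S} → S ∈ₗ both L₂ → remove v S ∈ₗ only-w L × v ∈ S
      back {S} S∈ with ∈-both⁻ L₂ S∈
      ... | S∈L₂ , v∈ , w∈ =
        ∈-only-w⁺ (listed enum (right-subtree⁻ (∉-remove-self v S) pruned)) (∉-remove-self v S) (∈-remove⁺ S w∈ (v≢w ∘ sym))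
        , v∈
        where
        pruned : IsSubtree' T₂′ (remove v S)
        pruned = remove-pendant pendant-right (v≢w ∘ sym) w∈ (enumerated enum₂ S∈L₂)
      trade : ∀ {S} → S ∈ₗ only-w L → z * weight y z T S ≡ y * weight y z T₂′ (insert v S)
      trade S∈ with ∈-only-w⁻ L S∈
      ... | _ , v∉ , w∈ = weight-right-grow y z (in-V₂ S∈) w∈ v∉

    only-w-left-empty : only-w L₁ ≡ []
    only-w-left-empty = no-members λ S∈ → let S∈L₁ , v∉ , w∈ = ∈-only-w⁻ L₁ S∈ in
      pendant-excluded pendant-left w∈ v∉ (enumerated enum₁ S∈L₁)

    only-v-right-empty : only-v L₂ ≡ []
    only-v-right-empty = no-members λ S∈ → let S∈L₂ , v∈ , w∉ = ∈-only-v⁻ L₂ S∈ in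
      pendant-excluded pendant-right v∈ w∉ (enumerated enum₂ S∈L₂)

    only-w-contract-empty : only-w L⊙ ≡ []
    only-w-contract-empty = no-members λ S∈ → let S∈L⊙ , v∉ , w∈ = ∈-only-w⁻ L⊙ S∈ in
      pendant-excluded pendant-contract w∈ v∉ (enumerated enum⊙ S∈L⊙)

    scaled-recurrence : (y + z) * Hbar T L y z ≡ y * (Hbar T₁′ L₁ y z + Hbar T₂′ L₂ y z) + z * Hbar T⊙ L⊙ y z
    scaled-recurrence = recurrence-algebra y z split split-left split-right split-contract
      only-v-left-grow only-w-right-grow only-v-contract-grow
      where
      Nb Na : ℚ
      Nb = H T (filter meets-V₂? (neither L))
      Na = H T (filter (∁? meets-V₂?) (neither L))
      split-neither : H T (neither L) ≡ Nb + Na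
      split-neither = sumℚ-partition meets-V₂? (weight y z T) (neither L)
      split : Hbar T L y z ≡ (H T (both L) + H T (only-v L)) + (H T (only-w L) + (Nb + Na))
      split = trans (decompose T L) (cong (H T (both L) + H T (only-v L) +_) (cong (H T (only-w L) +_) split-neither))
      split-left : Hbar T₁′ L₁ y z ≡ (H T₁′ (both L₁) + H T (only-v L)) + (0ℚ + Na)
      split-left = trans (decompose T₁′ L₁)
        (cong₂ _+_ (cong (H T₁′ (both L₁) +_) (sym only-v-left))
                   (cong₂ _+_ (cong (H T₁′) only-w-left-empty) (sym neither-left)))
      split-right : Hbar T₂′ L₂ y z ≡ (H T₂′ (both L₂) + 0ℚ) + (H T (only-w L) + Nb)
      split-right = trans (decompose T₂′ L₂)
        (cong₂ _+_ (cong (H T₂′ (both L₂) +_) (cong (H T₂′) only-v-right-empty))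
                   (cong₂ _+_ (sym only-w-right) (sym neither-right)))
      split-contract : Hbar T⊙ L⊙ y z ≡ (H T (both L) + H T⊙ (only-v L⊙)) + (0ℚ + (Nb + Na))
      split-contract = trans (decompose T⊙ L⊙)
        (cong₂ _+_ (cong (_+ H T⊙ (only-v L⊙)) (sym both-contract))
                   (cong₂ _+_ (cong (H T⊙) only-w-contract-empty) (trans (sym neither-contract) split-neither)))

proposition5p1 : ∀ {N : ℕ} (T₁ T₂ : Graph N) (v w : Fin N) →
    IsTree T₁ → IsTree T₂ →
    (∀ x → x ∈ verts T₁ → x ∉ verts T₂) →
    v ∈ verts T₁ → w ∈ verts T₂ →
    (L L₁ L₂ L⊙ : List (Subset N)) →
    Enumerates' (join T₁ T₂ v w) L →
    Enumerates' (addEdge T₁ w v w) L₁ →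
    Enumerates' (addEdge T₂ v v w) L₂ →
    Enumerates' (nearContract (join T₁ T₂ v w) v w) L⊙ →
    (y z : ℚ) → .{{_ : NonZero (y + z)}} →
    Hbar (join T₁ T₂ v w) L y z ≡
      ((y ÷ (y + z)) * (Hbar (addEdge T₁ w v w) L₁ y z + Hbar (addEdge T₂ v v w) L₂ y z))
      + ((z ÷ (y + z)) * Hbar (nearContract (join T₁ T₂ v w) v w) L⊙ y z)
proposition5p1 T₁ T₂ v w tree₁ tree₂ disjoint v∈T₁ w∈T₂ L L₁ L₂ L⊙ enum enum₁ enum₂ enum⊙ y z =
  divide-out y z (Decomposition.scaled-recurrence y z enum enum₁ enum₂ enum⊙)
  where open Bridge T₁ T₂ v w (IsTree.simple tree₁) (IsTree.simple tree₂) disjoint v∈T₁ w∈T₂
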